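{- Let $X$ be a weighted pure $n$-dimensional simplicial complex. Assume there are constants $C_0>0,\dots,C_{n-1}>0$ and $\varepsilon>0$ such that for every $0\le k\le n-1$ and every $0\ne\phi\in C^k(X,\mathbb{F}_2)$: if $\phi$ is $\varepsilon$-locally minimal and $\|\phi\|\le C_km(X^{(k)})$ then $\|d\phi\|>0$. Let $\mu=\max\{\frac1\varepsilon,\frac1{C_0},\frac2{C_1},\dots,\frac{n}{C_{n-1}}\}$ and $\nu=\min\{C_0,\dots,C_{n-1}\}$. Then: (1) for every $0\le k\le n-2$, $\mu_k(X)\le\mu$; (2) for every $0\le k\le n-1$, $\min\{\|\phi\|:\phi\in Z^k(X,\mathbb{F}_2)\setminus B^k(X,\mathbb{F}_2)\}\ge\nu\,m(X^{(k)})$.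
   Context: $X$ is finite, $X^{(k)}$ its $k$-simplices ($X^{(-1)}=\{\emptyset\}$). A weight is $m:\bigcup_kX^{(k)}\to(0,\infty)$ with $m(\tau)=\sum_{\sigma\in X^{(k+1)},\tau\subset\sigma}m(\sigma)$; $m(U)=\sum_{\sigma\in U}m(\sigma)$. $C^k(Y,\mathbb{F}_2)$ = functions $Y^{(k)}\to\mathbb{F}_2$, norm $\|\phi\|=\sum_{\phi(\tau)=1}m(\tau)$, differential $(d\phi)(\sigma)=\sum_{\tau\subset\sigma}\phi(\tau)$ mod 2; $C^{ -1}$ = functions on $\{\emptyset\}$ with $d\psi$ the constant $\psi(\emptyset)$; $B^k=d(C^{k-1})$, $Z^k=\ker d$ on $C^k$. Cofilling constant: $\mu_k(X)=\max_{0\ne\phi\in B^{k+1}(X,\mathbb{F}_2)}\frac1{\|\phi\|}\min\{\|\psi\|:\psi\in C^k(X,\mathbb{F}_2),d\psi=\phi\}$. Link $X_\tau$ ($\tau\in X^{(j)}$): simplices disjoint from $\tau$ with union in $X$, weight $m_\tau(\sigma)=m(\tau\cup\sigma)$; localization $\phi_\tau(\sigma)=\phi(\tau\cup\sigma)$. For $k\ge1$, $\phi$ is $\varepsilon$-locally minimal if for all $0\le j\le k-1$, $\tau\in X^{(j)}$, $\varphi\in B^{k-j-1}(X_\tau,\mathbb{F}_2)$: $\|\phi_\tau\|\le\|\phi_\tau-\varphi\|+\varepsilon m(\tau)$; for $k=0$: $\|\phi\|\le(1+\varepsilon)m(X^{(0)})/2$.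
   Formalization: The weight $m$ and the constants $C_0,\dots,C_{n-1}$ and $\varepsilon$ take rational values instead of real ones. -}

module Defs where

open import Data.Bool using (Bool; true; false; T; _∧_; _∨_; not; _xor_; if_then_else_)
open import Data.Nat as ℕ using (ℕ; zero; suc; _≡ᵇ_)
open import Data.Fin using (Fin; toℕ)
open import Data.List using (List; []; _∷_; map; filter; foldr; allFin; concatMap)
open import Data.Vec as Vec using (Vec; []; _∷_; lookup; zipWith; replicate; _[_]≔_)
open import Data.Rational as ℚ using (ℚ; 0ℚ; 1ℚ; _+_; _*_; _<_; _⊔_; _⊓_; 1/_; positive)
open import Data.Rational.Properties using (pos⇒nonZero)
open import Data.Product using (Σ; _×_; ∃)
open import Relation.Binary.PropositionalEquality using (_≡_)
open import Relation.Nullary.Decidable using (⌊_⌋)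
open import Function using (_∘_)

-- Vertices are Fin N; a (candidate) simplex is a subset of the vertex set,
-- encoded as a characteristic vector  Vec Bool N.

Simplex : ℕ → Set
Simplex N = Vec Bool N

∅ₛ : ∀ {N} → Simplex N
∅ₛ {N} = replicate N false

-- number of vertices (= dimension + 1)
card : ∀ {N} → Simplex N → ℕ
card [] = 0
card (true ∷ σ) = suc (card σ)
card (false ∷ σ) = card σ

_∪ₛ_ : ∀ {N} → Simplex N → Simplex N → Simplex N
_∪ₛ_ = zipWith _∨_

_⊆ᵇ_ : ∀ {N} → Simplex N → Simplex N → Bool
[] ⊆ᵇ [] = true
(a ∷ τ) ⊆ᵇ (b ∷ σ) = (not a ∨ b) ∧ (τ ⊆ᵇ σ)

disjointᵇ : ∀ {N} → Simplex N → Simplex N → Bool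
disjointᵇ [] [] = true
disjointᵇ (a ∷ τ) (b ∷ σ) = not (a ∧ b) ∧ disjointᵇ τ σ

allSimplices : (N : ℕ) → List (Simplex N)
allSimplices zero = [] ∷ []
allSimplices (suc N) = concatMap (λ σ → (true ∷ σ) ∷ (false ∷ σ) ∷ []) (allSimplices N)

faces : ∀ {N} → Simplex N → List (Simplex N)
faces {N} σ = map (λ i → σ [ i ]≔ false) (filter (λ i → T? (lookup σ i)) (allFin N))
  where
  open import Relation.Nullary using (Dec; yes; no)
  T? : (b : Bool) → Dec (T b)
  T? true = yes _
  T? false = no (λ ())

record Complex (N : ℕ) : Set where
  field
    face      : Simplex N → Bool
    has-empty : T (face ∅ₛ)
    down      : ∀ σ τ → T (τ ⊆ᵇ σ) → T (face σ) → T (face τ)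
open Complex public

-- pure n-dimensional: every simplex has ≤ n+1 vertices and lies in an n-simplex,
-- (in particular X has an n-simplex, since ∅ ∈ X)
IsPure : ∀ {N} → Complex N → ℕ → Set
IsPure X n =
  (∀ σ → T (face X σ) → card σ ℕ.≤ suc n) ×
  (∀ σ → T (face X σ) → Σ (Simplex _) λ ρ → T (face X ρ) × card ρ ≡ suc n × T (σ ⊆ᵇ ρ))

Σℚ : ∀ {N} → (Simplex N → Bool) → (Simplex N → ℚ) → ℚ
Σℚ {N} P f = foldr (λ σ acc → (if P σ then f σ else 0ℚ) + acc) 0ℚ (allSimplices N)

-- P is the (Boolean) membership predicate of a "complex" Y (X itself or a link);
-- cells of cardinality s (i.e. of dimension s-1)
cellᵇ : ∀ {N} → (Simplex N → Bool) → ℕ → Simplex N → Bool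
cellᵇ P s σ = P σ ∧ (card σ ≡ᵇ s)

mass : ∀ {N} → (Simplex N → Bool) → (Simplex N → ℚ) → ℕ → ℚ
mass P m s = Σℚ (cellᵇ P s) m

norm : ∀ {N} → (Simplex N → Bool) → (Simplex N → ℚ) → ℕ → (Simplex N → Bool) → ℚ
norm P m s φ = Σℚ (λ σ → cellᵇ P s σ ∧ φ σ) m

-- weight on X (weights on all simplices incl. ∅, positive, balanced below the top dimension)
IsWeight : ∀ {N} → Complex N → ℕ → (Simplex N → ℚ) → Set
IsWeight X n m =
  (∀ σ → T (face X σ) → 0ℚ < m σ) ×
  (∀ τ → T (face X τ) → card τ ℕ.≤ n →
     m τ ≡ Σℚ (λ σ → cellᵇ (face X) (suc (card τ)) σ ∧ (τ ⊆ᵇ σ)) m)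

-- F₂-cochains: functions Simplex N → Bool; only their values on the relevant
-- cells matter.  Coboundary: (dφ)(σ) = Σ_{τ ⊂ σ codim 1} φ(τ) mod 2.
-- For σ a vertex the only face is ∅, so this also covers d : C^{-1} → C^0.

d : ∀ {N} → (Simplex N → Bool) → (Simplex N → Bool)
d φ σ = foldr (λ τ acc → φ τ xor acc) false (faces σ)

AgreeOn : ∀ {N} → (Simplex N → Bool) → ℕ → (Simplex N → Bool) → (Simplex N → Bool) → Set
AgreeOn P s φ ψ = ∀ σ → T (P σ) → card σ ≡ s → φ σ ≡ ψ σ

Nonzero : ∀ {N} → (Simplex N → Bool) → ℕ → (Simplex N → Bool) → Set
Nonzero P s φ = Σ (Simplex _) λ σ → T (P σ) × card σ ≡ s × φ σ ≡ true

linkᵇ : ∀ {N} → Complex N → Simplex N → Simplex N → Bool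
linkᵇ X τ σ = disjointᵇ τ σ ∧ face X (τ ∪ₛ σ)

LocMin : ∀ {N} → Complex N → (Simplex N → ℚ) → ℚ → ℕ → (Simplex N → Bool) → Set
LocMin X m ε zero φ =
  norm (face X) m 1 φ ℚ.≤ ((1ℚ + ε) * mass (face X) m 1) * ℚ.½
LocMin X m ε (suc k) φ =
  -- j ≤ k, τ ∈ X^{(j)}, ϕ = dψ ∈ B^{(suc k)-j-1}(X_τ), cells of X_τ of cardinality (suc k) - j
  ∀ (j : ℕ) → j ℕ.≤ k → ∀ τ → T (face X τ) → card τ ≡ suc j →
  ∀ (ψ : Simplex _ → Bool) →
    norm (linkᵇ X τ) (m ∘ (τ ∪ₛ_)) (suc k ℕ.∸ j) (φ ∘ (τ ∪ₛ_))
      ℚ.≤ norm (linkᵇ X τ) (m ∘ (τ ∪ₛ_)) (suc k ℕ.∸ j) (λ σ → φ (τ ∪ₛ σ) xor d ψ σ)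
          + ε * m τ

inv : (p : ℚ) → 0ℚ < p → ℚ
inv p p>0 = (1/ p) {{pos⇒nonZero p {{positive p>0}}}}

μconst : (n : ℕ) (ε : ℚ) → 0ℚ < ε → (C : Fin n → ℚ) → (∀ i → 0ℚ < C i) → ℚ
μconst n ε εpos C Cpos =
  foldr _⊔_ (inv ε εpos)
    (map (λ i → ((+ suc (toℕ i)) ℚ./ 1) ℚ.* inv (C i) (Cpos i)) (allFin n))
  where open import Data.Integer using (+_)

-- ν = min{C₀, …, C_{n-1}}  (n ≥ 1 when used; value for n = 0 is irrelevant)
νconst : (n : ℕ) → (Fin n → ℚ) → ℚ
νconst zero C = 0ℚ
νconst (suc n) C = foldr _⊓_ (C Fin.zero) (map (C ∘ Fin.suc) (allFin n))
  where import Data.Fin as Fin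

{-# OPTIONS --safe #-}
module Submission where

-- Minimise ε‖ψ‖ + ‖φ + dψ‖ over all cochains ψ, a finite problem. For a minimiser ψ
-- no coboundary dχ lowers the norm of φ* = φ + dψ by more than ε‖χ‖. The local moves
-- at τ are the coboundaries of link cochains extended by zero, and such an extension
-- has norm at most m(τ), since by balancing the mass of the cells containing τ does not
-- grow with their dimension; for k = 0 the move is the constant (-1)-cochain, which
-- flips φ* on every vertex. So φ* is ε-locally minimal, and if φ is a cocycle, so is
-- φ*, whence φ* = 0 or ‖φ*‖ > C_k m(X^(k)) by hypothesis. For (2), φ* ≠ 0 as φ is not
-- a coboundary, and ‖φ*‖ ≤ ‖φ‖. For (1), with φ = dψ₀: if φ* = 0 then ψ fills φ and
-- ε‖ψ‖ ≤ ‖φ‖; otherwise ψ₀ itself will do, as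
-- ‖ψ₀‖ ≤ m(X^(k)) ≤ (k+2) m(X^(k+1)) < (k+2)/C_{k+1} ‖φ*‖ ≤ μ ‖φ‖.

open import Defs
open import Data.Bool using (Bool; T; false)
open import Data.Nat as ℕ using (ℕ; suc)
open import Data.Fin using (Fin; toℕ)
open import Data.Rational as ℚ using (ℚ; 0ℚ; _+_; _*_; _<_; _≤_)
open import Data.Product using (Σ; _×_)
open import Relation.Binary.PropositionalEquality using (_≡_)
open import Relation.Nullary using (¬_)

open import Algebra.Bundles using (CommutativeRing)
open import Data.Bool using (true; _∧_; not; _xor_; if_then_else_)
open import Data.Bool.Properties
  using (xor-assoc; xor-comm; xor-same; xor-identityʳ; true-xor; ∧-zeroʳ; ∧-identityʳ; ∧-distribˡ-xor;
         xor-∧-commutativeRing; T-∧; T-≡)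
open import Data.Empty using (⊥-elim)
open import Data.Fin as Fin using (zero; suc)
import Data.Fin.Properties as Finₚ
import Data.Integer as ℤ
import Data.Integer.Properties as ℤₚ
open import Data.List using (List; []; _∷_; _++_; map; filter; foldr; concatMap; allFin; tabulate)
open import Data.List.Membership.Propositional using (_∈_)
open import Data.List.Membership.Propositional.Properties using (∈-map⁺; ∈-allFin)
open import Data.List.Properties using (map-tabulate)
open import Data.List.Relation.Unary.Any using (here; there)
open import Data.Nat using (zero; _≡ᵇ_)
open import Data.Nat.Coprimality using (1-coprimeTo) renaming (sym to Coprime-sym)
import Data.Nat.Properties as ℕₚ
open import Data.Product using (_,_; proj₁; proj₂)
open import Data.Rational using (1ℚ; ½; _⊔_; _⊓_)
import Data.Rational.Properties as ℚₚ
import Data.Rational.Unnormalised as ℚᵘ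
import Data.Rational.Unnormalised.Properties as ℚᵘₚ
open import Data.Sum using (_⊎_; inj₁; inj₂)
open import Data.Vec as Vec using ([]; _∷_; lookup; _[_]≔_)
open import Function using (_∘_; id)
open import Function.Bundles using (Equivalence)
open import Level using (0ℓ)
open import Relation.Binary.PropositionalEquality
  using (refl; sym; trans; cong; cong₂; subst; _≢_; _≗_; module ≡-Reasoning)
open import Relation.Nullary using (Dec; does; yes; no)
open import Relation.Nullary.Decidable using (dec-true; dec-false; dec⇒maybe)
open import Relation.Unary using (Pred; Decidable)
open import Tactic.RingSolver using (solve-∀)
open import Tactic.RingSolver.Core.AlmostCommutativeRing using (AlmostCommutativeRing; fromCommutativeRing)

open import Algebra.Properties.CommutativeSemigroup
  (CommutativeRing.+-commutativeSemigroup xor-∧-commutativeRing) using () renaming (interchange to xor-interchange)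
open import Algebra.Properties.CommutativeSemigroup
  (CommutativeRing.+-commutativeSemigroup ℚₚ.+-*-commutativeRing) using () renaming (interchange to +-interchange)

-- Cochains and the coboundary

Cochain : ℕ → Set
Cochain N = Simplex N → Bool

0ᶜ : ∀ {N} → Cochain N
0ᶜ _ = false

_+ᶜ_ : ∀ {N} → Cochain N → Cochain N → Cochain N
(φ +ᶜ ψ) σ = φ σ xor ψ σ

infixl 6 _+ᶜ_

xor≡false⇒≡ : ∀ x y → x xor y ≡ false → x ≡ y
xor≡false⇒≡ true  true  _ = refl
xor≡false⇒≡ false false _ = refl

xor-true : ∀ x → x xor true ≡ not x
xor-true x = trans (xor-comm x true) (true-xor x)

xorSum : ∀ {A : Set} → List A → (A → Bool) → Bool
xorSum xs f = foldr (λ x acc → f x xor acc) false xs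

module _ {A : Set} where

  xorSum-cong : ∀ (xs : List A) {f g} → f ≗ g → xorSum xs f ≡ xorSum xs g
  xorSum-cong []       f≗g = refl
  xorSum-cong (x ∷ xs) f≗g = cong₂ _xor_ (f≗g x) (xorSum-cong xs f≗g)

  xorSum-xor : ∀ (xs : List A) f g → xorSum xs (λ x → f x xor g x) ≡ xorSum xs f xor xorSum xs g
  xorSum-xor []       f g = refl
  xorSum-xor (x ∷ xs) f g = trans (cong ((f x xor g x) xor_) (xorSum-xor xs f g))
                                  (xor-interchange (f x) (g x) (xorSum xs f) (xorSum xs g))

  xorSum-map : ∀ {B : Set} (g : B → A) (xs : List B) f → xorSum (map g xs) f ≡ xorSum xs (f ∘ g)
  xorSum-map g []       f = refl
  xorSum-map g (x ∷ xs) f = cong (f (g x) xor_) (xorSum-map g xs f)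

  xorSum-filter : ∀ {p} {P : Pred A p} (P? : Decidable P) (xs : List A) f →
    xorSum (filter P? xs) f ≡ xorSum xs (λ x → does (P? x) ∧ f x)
  xorSum-filter P? []       f = refl
  xorSum-filter P? (x ∷ xs) f with does (P? x)
  ... | true  = cong (f x xor_) (xorSum-filter P? xs f)
  ... | false = xorSum-filter P? xs f

does-T : ∀ {b} (b? : Dec (T b)) → does b? ≡ b
does-T {true}  b? = dec-true b? _
does-T {false} b? = dec-false b? id

xorSum-faces : ∀ {N} (φ : Cochain N) σ (T? : ∀ i → Dec (T (lookup σ i))) →
  xorSum (map (λ i → σ [ i ]≔ false) (filter T? (allFin N))) φ
    ≡ xorSum (allFin N) (λ i → lookup σ i ∧ φ (σ [ i ]≔ false))
xorSum-faces {N} φ σ T? = begin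
  xorSum (map drop (filter T? (allFin N))) φ           ≡⟨ xorSum-map drop (filter T? (allFin N)) φ ⟩
  xorSum (filter T? (allFin N)) (φ ∘ drop)             ≡⟨ xorSum-filter T? (allFin N) (φ ∘ drop) ⟩
  xorSum (allFin N) (λ i → does (T? i) ∧ φ (drop i))   ≡⟨ xorSum-cong (allFin N) (λ i → cong (_∧ φ (drop i)) (does-T (T? i))) ⟩
  xorSum (allFin N) (λ i → lookup σ i ∧ φ (drop i))    ∎
  where
  open ≡-Reasoning
  drop : Fin N → Simplex N
  drop i = σ [ i ]≔ false

-- faces filters with a decision procedure local to Defs; xorSum-faces holds for any
-- decision procedure, so unification supplies that one here.
d≡xorSum : ∀ {N} (φ : Cochain N) σ →
  d φ σ ≡ xorSum (allFin N) (λ i → lookup σ i ∧ φ (σ [ i ]≔ false))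
d≡xorSum φ σ = xorSum-faces φ σ _

d-∷ : ∀ {N} (φ : Cochain (suc N)) b σ → d φ (b ∷ σ) ≡ (b ∧ φ (false ∷ σ)) xor d (φ ∘ (b ∷_)) σ
d-∷ {N} φ b σ = begin
  d φ (b ∷ σ)                                          ≡⟨ d≡xorSum φ (b ∷ σ) ⟩
  g zero xor xorSum (tabulate suc) g                   ≡⟨ cong (λ is → g zero xor xorSum is g) (map-tabulate id suc) ⟨
  g zero xor xorSum (map suc (allFin N)) g             ≡⟨ cong (g zero xor_) (xorSum-map suc (allFin N) g) ⟩
  g zero xor xorSum (allFin N) (g ∘ suc)               ≡⟨ cong (g zero xor_) (d≡xorSum (φ ∘ (b ∷_)) σ) ⟨
  (b ∧ φ (false ∷ σ)) xor d (φ ∘ (b ∷_)) σ             ∎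
  where
  open ≡-Reasoning
  g : Fin (suc N) → Bool
  g i = lookup (b ∷ σ) i ∧ φ ((b ∷ σ) [ i ]≔ false)

d-cong : ∀ {N} {φ ψ : Cochain N} → φ ≗ ψ → d φ ≗ d ψ
d-cong {N} {φ} {ψ} φ≗ψ σ = begin
  d φ σ                                                   ≡⟨ d≡xorSum φ σ ⟩
  xorSum (allFin N) (λ i → lookup σ i ∧ φ (σ [ i ]≔ false)) ≡⟨ xorSum-cong (allFin N) (λ i → cong (lookup σ i ∧_) (φ≗ψ _)) ⟩
  xorSum (allFin N) (λ i → lookup σ i ∧ ψ (σ [ i ]≔ false)) ≡⟨ d≡xorSum ψ σ ⟨
  d ψ σ                                                   ∎
  where open ≡-Reasoning

d-+ᶜ : ∀ {N} (φ ψ : Cochain N) σ → d (φ +ᶜ ψ) σ ≡ d φ σ xor d ψ σ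
d-+ᶜ {N} φ ψ σ = begin
  d (φ +ᶜ ψ) σ                                   ≡⟨ d≡xorSum (φ +ᶜ ψ) σ ⟩
  xorSum (allFin N) (λ i → b i ∧ (f i xor g i))   ≡⟨ xorSum-cong (allFin N) (λ i → ∧-distribˡ-xor (b i) (f i) (g i)) ⟩
  xorSum (allFin N) (λ i → (b i ∧ f i) xor (b i ∧ g i)) ≡⟨ xorSum-xor (allFin N) (λ i → b i ∧ f i) (λ i → b i ∧ g i) ⟩
  xorSum (allFin N) (λ i → b i ∧ f i) xor xorSum (allFin N) (λ i → b i ∧ g i)
                                                 ≡⟨ cong₂ _xor_ (d≡xorSum φ σ) (d≡xorSum ψ σ) ⟨
  d φ σ xor d ψ σ                                ∎
  where
  open ≡-Reasoning
  b : Fin N → Bool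
  b i = lookup σ i
  f g : Fin N → Bool
  f i = φ (σ [ i ]≔ false)
  g i = ψ (σ [ i ]≔ false)

d-0ᶜ : ∀ {N} (σ : Simplex N) → d 0ᶜ σ ≡ false
d-0ᶜ σ = trans (d-+ᶜ 0ᶜ 0ᶜ σ) (xor-same (d 0ᶜ σ))

d-∧ : ∀ {N} b (φ : Cochain N) σ → d (λ ρ → b ∧ φ ρ) σ ≡ b ∧ d φ σ
d-∧ true  φ σ = refl
d-∧ false φ σ = d-0ᶜ σ

d∘d : ∀ {N} (φ : Cochain N) σ → d (d φ) σ ≡ false
d∘d φ []      = refl
d∘d φ (b ∷ σ) = begin
  d (d φ) (b ∷ σ)                                   ≡⟨ d-∷ (d φ) b σ ⟩
  (b ∧ d φ (false ∷ σ)) xor d (d φ ∘ (b ∷_)) σ      ≡⟨ cong₂ (λ x y → (b ∧ x) xor y) (d-∷ φ false σ) (d-cong (d-∷ φ b) σ) ⟩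
  (b ∧ A) xor d ((λ ρ → b ∧ φ (false ∷ ρ)) +ᶜ d (φ ∘ (b ∷_))) σ
                                                    ≡⟨ cong ((b ∧ A) xor_) (d-+ᶜ (λ ρ → b ∧ φ (false ∷ ρ)) (d (φ ∘ (b ∷_))) σ) ⟩
  (b ∧ A) xor (d (λ ρ → b ∧ φ (false ∷ ρ)) σ xor d (d (φ ∘ (b ∷_))) σ)
                                                    ≡⟨ cong₂ (λ x y → (b ∧ A) xor (x xor y)) (d-∧ b _ σ) (d∘d (φ ∘ (b ∷_)) σ) ⟩
  (b ∧ A) xor ((b ∧ A) xor false)                   ≡⟨ cong ((b ∧ A) xor_) (xor-identityʳ (b ∧ A)) ⟩
  (b ∧ A) xor (b ∧ A)                               ≡⟨ xor-same (b ∧ A) ⟩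
  false                                             ∎
  where
  open ≡-Reasoning
  A : Bool
  A = d (φ ∘ (false ∷_)) σ

d-+ᶜ-d : ∀ {N} (φ ψ : Cochain N) σ → d (φ +ᶜ d ψ) σ ≡ d φ σ
d-+ᶜ-d φ ψ σ = trans (d-+ᶜ φ (d ψ) σ) (trans (cong (d φ σ xor_) (d∘d ψ σ)) (xor-identityʳ (d φ σ)))

card≡0⇒∅ₛ : ∀ {N} (σ : Simplex N) → card σ ≡ 0 → σ ≡ ∅ₛ
card≡0⇒∅ₛ []          _ = refl
card≡0⇒∅ₛ (false ∷ σ) e = cong (false ∷_) (card≡0⇒∅ₛ σ e)

d-card≡0 : ∀ {N} (φ : Cochain N) σ → card σ ≡ 0 → d φ σ ≡ false
d-card≡0 φ []          _ = refl
d-card≡0 φ (false ∷ σ) e = trans (d-∷ φ false σ) (d-card≡0 (φ ∘ (false ∷_)) σ e)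

d-vertex : ∀ {N} (φ : Cochain N) σ → card σ ≡ 1 → d φ σ ≡ φ ∅ₛ
d-vertex φ (true ∷ σ) e = begin
  d φ (true ∷ σ)                           ≡⟨ d-∷ φ true σ ⟩
  φ (false ∷ σ) xor d (φ ∘ (true ∷_)) σ    ≡⟨ cong (φ (false ∷ σ) xor_) (d-card≡0 (φ ∘ (true ∷_)) σ σ-empty) ⟩
  φ (false ∷ σ) xor false                  ≡⟨ xor-identityʳ (φ (false ∷ σ)) ⟩
  φ (false ∷ σ)                            ≡⟨ cong (φ ∘ (false ∷_)) (card≡0⇒∅ₛ σ σ-empty) ⟩
  φ ∅ₛ                                     ∎
  where
  open ≡-Reasoning
  σ-empty : card σ ≡ 0
  σ-empty = ℕₚ.suc-injective e
d-vertex φ (false ∷ σ) e = trans (d-∷ φ false σ) (d-vertex (φ ∘ (false ∷_)) σ e)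

-- Extension of link cochains by zero

lift : ∀ {N} → Simplex N → Cochain N → Cochain N
lift []          ψ []          = ψ []
lift (true ∷ τ)  ψ (true ∷ ρ)  = lift τ (ψ ∘ (false ∷_)) ρ
lift (true ∷ τ)  ψ (false ∷ ρ) = false
lift (false ∷ τ) ψ (b ∷ ρ)     = lift τ (ψ ∘ (b ∷_)) ρ

lift-∪ : ∀ {N} (τ σ : Simplex N) ψ → disjointᵇ τ σ ≡ true → lift τ ψ (τ ∪ₛ σ) ≡ ψ σ
lift-∪ []          []          ψ _ = refl
lift-∪ (true ∷ τ)  (false ∷ σ) ψ e = lift-∪ τ σ (ψ ∘ (false ∷_)) e
lift-∪ (false ∷ τ) (b ∷ σ)     ψ e = lift-∪ τ σ (ψ ∘ (b ∷_)) e

lift-off : ∀ {N} (τ ρ : Simplex N) ψ → (τ ⊆ᵇ ρ) ≡ false → lift τ ψ ρ ≡ false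
lift-off []          []          ψ ()
lift-off (true ∷ τ)  (true ∷ ρ)  ψ e = lift-off τ ρ (ψ ∘ (false ∷_)) e
lift-off (true ∷ τ)  (false ∷ ρ) ψ e = refl
lift-off (false ∷ τ) (b ∷ ρ)     ψ e = lift-off τ ρ (ψ ∘ (b ∷_)) e

d-lift-∪ : ∀ {N} (τ σ : Simplex N) ψ → disjointᵇ τ σ ≡ true → d (lift τ ψ) (τ ∪ₛ σ) ≡ d ψ σ
d-lift-∪ []          []          ψ e = refl
d-lift-∪ (true ∷ τ)  (false ∷ σ) ψ e = begin
  d (lift (true ∷ τ) ψ) (true ∷ (τ ∪ₛ σ))    ≡⟨ d-∷ (lift (true ∷ τ) ψ) true (τ ∪ₛ σ) ⟩
  d (lift τ (ψ ∘ (false ∷_))) (τ ∪ₛ σ)       ≡⟨ d-lift-∪ τ σ (ψ ∘ (false ∷_)) e ⟩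
  d (ψ ∘ (false ∷_)) σ                       ≡⟨ d-∷ ψ false σ ⟨
  d ψ (false ∷ σ)                            ∎
  where open ≡-Reasoning
d-lift-∪ (false ∷ τ) (b ∷ σ)     ψ e = begin
  d (lift (false ∷ τ) ψ) (b ∷ (τ ∪ₛ σ))
    ≡⟨ d-∷ (lift (false ∷ τ) ψ) b (τ ∪ₛ σ) ⟩
  (b ∧ lift τ (ψ ∘ (false ∷_)) (τ ∪ₛ σ)) xor d (lift τ (ψ ∘ (b ∷_))) (τ ∪ₛ σ)
    ≡⟨ cong₂ (λ x y → (b ∧ x) xor y) (lift-∪ τ σ (ψ ∘ (false ∷_)) e) (d-lift-∪ τ σ (ψ ∘ (b ∷_)) e) ⟩
  (b ∧ ψ (false ∷ σ)) xor d (ψ ∘ (b ∷_)) σ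
    ≡⟨ d-∷ ψ b σ ⟨
  d ψ (b ∷ σ) ∎
  where open ≡-Reasoning

d-lift-off : ∀ {N} (τ ρ : Simplex N) ψ → (τ ⊆ᵇ ρ) ≡ false → d (lift τ ψ) ρ ≡ false
d-lift-off []          []          ψ ()
d-lift-off (true ∷ τ)  (true ∷ ρ)  ψ e =
  trans (d-∷ (lift (true ∷ τ) ψ) true ρ) (d-lift-off τ ρ (ψ ∘ (false ∷_)) e)
d-lift-off (true ∷ τ)  (false ∷ ρ) ψ e = trans (d-∷ (lift (true ∷ τ) ψ) false ρ) (d-0ᶜ ρ)
d-lift-off (false ∷ τ) (b ∷ ρ)     ψ e = begin
  d (lift (false ∷ τ) ψ) (b ∷ ρ)
    ≡⟨ d-∷ (lift (false ∷ τ) ψ) b ρ ⟩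
  (b ∧ lift τ (ψ ∘ (false ∷_)) ρ) xor d (lift τ (ψ ∘ (b ∷_))) ρ
    ≡⟨ cong₂ (λ x y → (b ∧ x) xor y) (lift-off τ ρ (ψ ∘ (false ∷_)) e) (d-lift-off τ ρ (ψ ∘ (b ∷_)) e) ⟩
  (b ∧ false) xor false
    ≡⟨ cong (_xor false) (∧-zeroʳ b) ⟩
  false ∎
  where open ≡-Reasoning

lift-in-star : ∀ {N} (τ : Simplex N) ψ ρ → lift τ ψ ρ ≡ true → (τ ⊆ᵇ ρ) ≡ true
lift-in-star τ ψ ρ lift≡true with τ ⊆ᵇ ρ in τ⊆ρ
... | true  = refl
... | false = trans (sym (lift-off τ ρ ψ τ⊆ρ)) lift≡true

∑ : ∀ {A : Set} → List A → (A → ℚ) → ℚ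
∑ xs f = foldr (λ x acc → f x + acc) 0ℚ xs

module _ {A : Set} where

  ∑-cong : ∀ (xs : List A) {f g} → f ≗ g → ∑ xs f ≡ ∑ xs g
  ∑-cong []       f≗g = refl
  ∑-cong (x ∷ xs) f≗g = cong₂ _+_ (f≗g x) (∑-cong xs f≗g)

  ∑-mono : ∀ (xs : List A) {f g} → (∀ x → f x ≤ g x) → ∑ xs f ≤ ∑ xs g
  ∑-mono []       f≤g = ℚₚ.≤-refl
  ∑-mono (x ∷ xs) f≤g = ℚₚ.+-mono-≤ (f≤g x) (∑-mono xs f≤g)

  ∑-vanish : ∀ (xs : List A) {f} → (∀ x → f x ≡ 0ℚ) → ∑ xs f ≡ 0ℚ
  ∑-vanish []       f≡0 = refl
  ∑-vanish (x ∷ xs) f≡0 = trans (cong₂ _+_ (f≡0 x) (∑-vanish xs f≡0)) (ℚₚ.+-identityˡ 0ℚ)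

  ∑-+ : ∀ (xs : List A) f g → ∑ xs (λ x → f x + g x) ≡ ∑ xs f + ∑ xs g
  ∑-+ []       f g = refl
  ∑-+ (x ∷ xs) f g = trans (cong (f x + g x +_) (∑-+ xs f g)) (+-interchange (f x) (g x) (∑ xs f) (∑ xs g))

  ∑-*ˡ : ∀ (xs : List A) c f → ∑ xs (λ x → c * f x) ≡ c * ∑ xs f
  ∑-*ˡ []       c f = sym (ℚₚ.*-zeroʳ c)
  ∑-*ˡ (x ∷ xs) c f = trans (cong (c * f x +_) (∑-*ˡ xs c f)) (sym (ℚₚ.*-distribˡ-+ c (f x) (∑ xs f)))

  ∑-*ʳ : ∀ (xs : List A) c f → ∑ xs (λ x → f x * c) ≡ ∑ xs f * c
  ∑-*ʳ xs c f = trans (∑-cong xs (λ x → ℚₚ.*-comm (f x) c)) (trans (∑-*ˡ xs c f) (ℚₚ.*-comm c (∑ xs f)))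

  ∑-nonneg : ∀ (xs : List A) {f} → (∀ x → 0ℚ ≤ f x) → 0ℚ ≤ ∑ xs f
  ∑-nonneg xs f≥0 = ℚₚ.≤-trans (ℚₚ.≤-reflexive (sym (∑-vanish xs (λ _ → refl)))) (∑-mono xs f≥0)

  ∑-pos : ∀ (xs : List A) f → 0ℚ < ∑ xs f → Σ A λ x → 0ℚ < f x
  ∑-pos []       f ∑>0 = ⊥-elim (ℚₚ.<-irrefl refl ∑>0)
  ∑-pos (x ∷ xs) f ∑>0 with 0ℚ ℚₚ.<? f x
  ... | yes fx>0 = x , fx>0
  ... | no  fx≯0 = ∑-pos xs f (ℚₚ.<-≤-trans ∑>0 (begin
    f x + ∑ xs f  ≤⟨ ℚₚ.+-monoˡ-≤ (∑ xs f) (ℚₚ.≮⇒≥ fx≯0) ⟩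
    0ℚ + ∑ xs f   ≡⟨ ℚₚ.+-identityˡ (∑ xs f) ⟩
    ∑ xs f        ∎))
    where open ℚₚ.≤-Reasoning

  ∑-++ : ∀ (xs ys : List A) f → ∑ (xs ++ ys) f ≡ ∑ xs f + ∑ ys f
  ∑-++ []       ys f = sym (ℚₚ.+-identityˡ (∑ ys f))
  ∑-++ (x ∷ xs) ys f = trans (cong (f x +_) (∑-++ xs ys f)) (sym (ℚₚ.+-assoc (f x) (∑ xs f) (∑ ys f)))

  ∑-concatMap : ∀ {B : Set} (g : B → List A) (ys : List B) f →
    ∑ (concatMap g ys) f ≡ ∑ ys (λ y → ∑ (g y) f)
  ∑-concatMap g []       f = refl
  ∑-concatMap g (y ∷ ys) f = trans (∑-++ (g y) (concatMap g ys) f) (cong (∑ (g y) f +_) (∑-concatMap g ys f))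

∑-swap : ∀ {A B : Set} (xs : List A) (ys : List B) (h : A → B → ℚ) →
  ∑ xs (λ x → ∑ ys (h x)) ≡ ∑ ys (λ y → ∑ xs (λ x → h x y))
∑-swap []       ys h = sym (∑-vanish ys (λ _ → refl))
∑-swap (x ∷ xs) ys h =
  trans (cong (∑ ys (h x) +_) (∑-swap xs ys h)) (sym (∑-+ ys (h x) (λ y → ∑ xs (λ x′ → h x′ y))))

∑ₛ : ∀ {N} → (Simplex N → ℚ) → ℚ
∑ₛ {N} = ∑ (allSimplices N)

∑ₛ-∷ : ∀ {N} (f : Simplex (suc N) → ℚ) → ∑ₛ f ≡ ∑ₛ (f ∘ (true ∷_)) + ∑ₛ (f ∘ (false ∷_))
∑ₛ-∷ {N} f = begin
  ∑ₛ f                                                   ≡⟨ ∑-concatMap _ (allSimplices N) f ⟩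
  ∑ (allSimplices N) (λ σ → f (true ∷ σ) + (f (false ∷ σ) + 0ℚ))
    ≡⟨ ∑-cong (allSimplices N) (λ σ → cong (f (true ∷ σ) +_) (ℚₚ.+-identityʳ (f (false ∷ σ)))) ⟩
  ∑ (allSimplices N) (λ σ → f (true ∷ σ) + f (false ∷ σ)) ≡⟨ ∑-+ (allSimplices N) (f ∘ (true ∷_)) (f ∘ (false ∷_)) ⟩
  ∑ₛ (f ∘ (true ∷_)) + ∑ₛ (f ∘ (false ∷_))               ∎
  where open ≡-Reasoning

∑ₛ-single : ∀ {N} {f : Simplex N → ℚ} → (∀ ρ → 0ℚ ≤ f ρ) → ∀ σ → f σ ≤ ∑ₛ f
∑ₛ-single {f = f} f≥0 [] = ℚₚ.≤-reflexive (sym (ℚₚ.+-identityʳ (f [])))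
∑ₛ-single {suc N} {f} f≥0 (true ∷ σ) = begin
  f (true ∷ σ)                              ≤⟨ ∑ₛ-single (f≥0 ∘ (true ∷_)) σ ⟩
  ∑ₛ (f ∘ (true ∷_))                        ≡⟨ ℚₚ.+-identityʳ _ ⟨
  ∑ₛ (f ∘ (true ∷_)) + 0ℚ                   ≤⟨ ℚₚ.+-monoʳ-≤ (∑ₛ (f ∘ (true ∷_))) (∑-nonneg (allSimplices N) (f≥0 ∘ (false ∷_))) ⟩
  ∑ₛ (f ∘ (true ∷_)) + ∑ₛ (f ∘ (false ∷_))  ≡⟨ ∑ₛ-∷ f ⟨
  ∑ₛ f                                      ∎
  where open ℚₚ.≤-Reasoning
∑ₛ-single {suc N} {f} f≥0 (false ∷ σ) = begin
  f (false ∷ σ)                             ≤⟨ ∑ₛ-single (f≥0 ∘ (false ∷_)) σ ⟩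
  ∑ₛ (f ∘ (false ∷_))                       ≡⟨ ℚₚ.+-identityˡ _ ⟨
  0ℚ + ∑ₛ (f ∘ (false ∷_))                  ≤⟨ ℚₚ.+-monoˡ-≤ (∑ₛ (f ∘ (false ∷_))) (∑-nonneg (allSimplices N) (f≥0 ∘ (true ∷_))) ⟩
  ∑ₛ (f ∘ (true ∷_)) + ∑ₛ (f ∘ (false ∷_))  ≡⟨ ∑ₛ-∷ f ⟨
  ∑ₛ f                                      ∎
  where open ℚₚ.≤-Reasoning

∑ₛ-point : ∀ {N} (f : Simplex N → ℚ) τ → (∀ ρ → ρ ≢ τ → f ρ ≡ 0ℚ) → ∑ₛ f ≡ f τ
∑ₛ-point f [] _ = ℚₚ.+-identityʳ (f [])
∑ₛ-point {suc N} f (true ∷ τ) f≡0 = begin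
  ∑ₛ f                                      ≡⟨ ∑ₛ-∷ f ⟩
  ∑ₛ (f ∘ (true ∷_)) + ∑ₛ (f ∘ (false ∷_))  ≡⟨ cong₂ _+_ (∑ₛ-point (f ∘ (true ∷_)) τ (λ ρ ρ≢τ → f≡0 (true ∷ ρ) (ρ≢τ ∘ cong Vec.tail)))
                                                          (∑-vanish (allSimplices N) (λ ρ → f≡0 (false ∷ ρ) (λ ()))) ⟩
  f (true ∷ τ) + 0ℚ                         ≡⟨ ℚₚ.+-identityʳ (f (true ∷ τ)) ⟩
  f (true ∷ τ)                              ∎
  where open ≡-Reasoning
∑ₛ-point {suc N} f (false ∷ τ) f≡0 = begin
  ∑ₛ f                                      ≡⟨ ∑ₛ-∷ f ⟩
  ∑ₛ (f ∘ (true ∷_)) + ∑ₛ (f ∘ (false ∷_))  ≡⟨ cong₂ _+_ (∑-vanish (allSimplices N) (λ ρ → f≡0 (true ∷ ρ) (λ ())))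
                                                          (∑ₛ-point (f ∘ (false ∷_)) τ (λ ρ ρ≢τ → f≡0 (false ∷ ρ) (ρ≢τ ∘ cong Vec.tail))) ⟩
  0ℚ + f (false ∷ τ)                        ≡⟨ ℚₚ.+-identityˡ (f (false ∷ τ)) ⟩
  f (false ∷ τ)                             ∎
  where open ≡-Reasoning

-- The summand of Σℚ in Defs: a norm or mass is ∑ₛ of ind-terms by definition.
ind : Bool → ℚ → ℚ
ind b x = if b then x else 0ℚ

ind-nonneg : ∀ b {x} → (T b → 0ℚ ≤ x) → 0ℚ ≤ ind b x
ind-nonneg true  x≥0 = x≥0 _
ind-nonneg false _   = ℚₚ.≤-refl

ind-pos : ∀ b {x} → 0ℚ < ind b x → T b
ind-pos true  _   = _
ind-pos false 0<0 = ⊥-elim (ℚₚ.<-irrefl refl 0<0)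

ind-0 : ∀ b → ind b 0ℚ ≡ 0ℚ
ind-0 true  = refl
ind-0 false = refl

ind-cong : ∀ b {x y} → (T b → x ≡ y) → ind b x ≡ ind b y
ind-cong true  x≡y = x≡y _
ind-cong false _   = refl

ind-≤ : ∀ b {x y} → 0ℚ ≤ y → (T b → x ≤ y) → ind b x ≤ y
ind-≤ true  _   x≤y = x≤y _
ind-≤ false y≥0 _   = y≥0

ind-1* : ∀ b x → ind b 1ℚ * x ≡ ind b x
ind-1* true  x = ℚₚ.*-identityˡ x
ind-1* false x = ℚₚ.*-zeroˡ x

ind-∑ : ∀ {A : Set} b (xs : List A) f → ind b (∑ xs f) ≡ ∑ xs (λ x → ind b (f x))
ind-∑ true  xs f = refl
ind-∑ false xs f = sym (∑-vanish xs (λ _ → refl))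

ind-∧-cong : ∀ a {b b′} x → (T a → b ≡ b′) → ind (a ∧ b) x ≡ ind (a ∧ b′) x
ind-∧-cong true  x b≡b′ = cong (λ b → ind b x) (b≡b′ _)
ind-∧-cong false x _    = refl

ind-∧-≤ : ∀ a b {x} → 0ℚ ≤ ind a x → ind (a ∧ b) x ≤ ind a x
ind-∧-≤ false _     _   = ℚₚ.≤-refl
ind-∧-≤ true  true  _   = ℚₚ.≤-refl
ind-∧-≤ true  false x≥0 = x≥0

ind-∧-mono : ∀ a {b b′ x} → (b ≡ true → b′ ≡ true) → 0ℚ ≤ ind a x → ind (a ∧ b) x ≤ ind (a ∧ b′) x
ind-∧-mono false             _    _   = ℚₚ.≤-refl
ind-∧-mono true {false} {b′} _    x≥0 = ind-nonneg b′ (λ _ → x≥0)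
ind-∧-mono true {true}       b⇒b′ _   rewrite b⇒b′ refl = ℚₚ.≤-refl

ind-∧-xor : ∀ a b c {x} → 0ℚ ≤ ind a x → ind (a ∧ (b xor c)) x ≤ ind (a ∧ b) x + ind (a ∧ c) x
ind-∧-xor false _     _         _   = ℚₚ.≤-refl
ind-∧-xor true  false false     _   = ℚₚ.≤-refl
ind-∧-xor true  true  false {x} _   = ℚₚ.≤-reflexive (sym (ℚₚ.+-identityʳ x))
ind-∧-xor true  false true  {x} _   = ℚₚ.≤-reflexive (sym (ℚₚ.+-identityˡ x))
ind-∧-xor true  true  true      x≥0 = ℚₚ.+-mono-≤ x≥0 x≥0

ind-∧-not : ∀ a b x → ind (a ∧ b) x + ind (a ∧ not b) x ≡ ind a x
ind-∧-not false _     _ = refl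
ind-∧-not true  true  x = ℚₚ.+-identityʳ x
ind-∧-not true  false x = ℚₚ.+-identityˡ x

ind-∧-split : ∀ a b c x → ind (a ∧ c) x ≡ ind (a ∧ (b ∧ c)) x + ind (a ∧ (not b ∧ c)) x
ind-∧-split false _     _     _ = refl
ind-∧-split true  true  false _ = refl
ind-∧-split true  false false _ = refl
ind-∧-split true  true  true  x = sym (ℚₚ.+-identityʳ x)
ind-∧-split true  false true  x = sym (ℚₚ.+-identityˡ x)

ind-ind : ∀ a b c x → ind a (ind (b ∧ c) x) ≡ ind (b ∧ (a ∧ c)) x
ind-ind true  _     _ _ = refl
ind-ind false false _ _ = refl
ind-ind false true  _ _ = refl

ind-∧-forget : ∀ a b e {x} → 0ℚ ≤ x → ind ((a ∧ b) ∧ true) (ind e x) ≤ ind (e ∧ b) x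
ind-∧-forget false b     e     x≥0 = ind-nonneg (e ∧ b) (λ _ → x≥0)
ind-∧-forget true  false e     x≥0 = ind-nonneg (e ∧ false) (λ _ → x≥0)
ind-∧-forget true  true  true  _   = ℚₚ.≤-refl
ind-∧-forget true  true  false _   = ℚₚ.≤-refl

∑ₛ-∪-reindex : ∀ {N} (τ : Simplex N) (f : Simplex N → ℚ) →
  ∑ₛ (λ σ → ind (disjointᵇ τ σ) (f (τ ∪ₛ σ))) ≡ ∑ₛ (λ ρ → ind (τ ⊆ᵇ ρ) (f ρ))
∑ₛ-∪-reindex [] f = refl
∑ₛ-∪-reindex {suc N} (true ∷ τ) f = begin
  ∑ₛ (λ σ → ind (disjointᵇ (true ∷ τ) σ) (f ((true ∷ τ) ∪ₛ σ)))
    ≡⟨ ∑ₛ-∷ (λ σ → ind (disjointᵇ (true ∷ τ) σ) (f ((true ∷ τ) ∪ₛ σ))) ⟩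
  ∑ₛ0 + ∑ₛ (λ σ → ind (disjointᵇ τ σ) (f (true ∷ (τ ∪ₛ σ))))
    ≡⟨ cong (∑ₛ0 +_) (∑ₛ-∪-reindex τ (f ∘ (true ∷_))) ⟩
  ∑ₛ0 + ∑ₛ (λ ρ → ind (τ ⊆ᵇ ρ) (f (true ∷ ρ)))
    ≡⟨ ℚₚ.+-comm ∑ₛ0 _ ⟩
  ∑ₛ (λ ρ → ind (τ ⊆ᵇ ρ) (f (true ∷ ρ))) + ∑ₛ0
    ≡⟨ ∑ₛ-∷ (λ ρ → ind ((true ∷ τ) ⊆ᵇ ρ) (f ρ)) ⟨
  ∑ₛ (λ ρ → ind ((true ∷ τ) ⊆ᵇ ρ) (f ρ)) ∎
  where
  open ≡-Reasoning
  ∑ₛ0 : ℚ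
  ∑ₛ0 = ∑ₛ {N} (λ _ → 0ℚ)
∑ₛ-∪-reindex {suc N} (false ∷ τ) f = begin
  ∑ₛ (λ σ → ind (disjointᵇ (false ∷ τ) σ) (f ((false ∷ τ) ∪ₛ σ)))
    ≡⟨ ∑ₛ-∷ (λ σ → ind (disjointᵇ (false ∷ τ) σ) (f ((false ∷ τ) ∪ₛ σ))) ⟩
  ∑ₛ (λ σ → ind (disjointᵇ τ σ) (f (true ∷ (τ ∪ₛ σ)))) + ∑ₛ (λ σ → ind (disjointᵇ τ σ) (f (false ∷ (τ ∪ₛ σ))))
    ≡⟨ cong₂ _+_ (∑ₛ-∪-reindex τ (f ∘ (true ∷_))) (∑ₛ-∪-reindex τ (f ∘ (false ∷_))) ⟩
  ∑ₛ (λ ρ → ind (τ ⊆ᵇ ρ) (f (true ∷ ρ))) + ∑ₛ (λ ρ → ind (τ ⊆ᵇ ρ) (f (false ∷ ρ)))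
    ≡⟨ ∑ₛ-∷ (λ ρ → ind ((false ∷ τ) ⊆ᵇ ρ) (f ρ)) ⟨
  ∑ₛ (λ ρ → ind ((false ∷ τ) ⊆ᵇ ρ) (f ρ)) ∎
  where open ≡-Reasoning

toℚ : ℕ → ℚ
toℚ n = (ℤ.+ n) ℚ./ 1

toℚ≡mkℚ : ∀ n → toℚ n ≡ ℚ.mkℚ (ℤ.+ n) 0 (Coprime-sym (1-coprimeTo n))
toℚ≡mkℚ n = ℚₚ.normalize-coprime (Coprime-sym (1-coprimeTo n))

toℚ-suc : ∀ n → toℚ (suc n) ≡ toℚ n + 1ℚ
toℚ-suc n = ℚₚ.toℚᵘ-injective (begin
  ℚ.toℚᵘ (toℚ (suc n))                       ≈⟨ ℚᵘₚ.≃-reflexive (cong ℚ.toℚᵘ (toℚ≡mkℚ (suc n))) ⟩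
  ℚᵘ.mkℚᵘ (ℤ.+ suc n) 0                      ≈⟨ ℚᵘ.*≡* (cong (ℤ._* ℤ.+ 1) n+1≡1+n) ⟩
  ℚᵘ.mkℚᵘ (ℤ.+ n) 0 ℚᵘ.+ ℚ.toℚᵘ 1ℚ           ≈⟨ ℚᵘₚ.≃-reflexive (cong (λ q → ℚ.toℚᵘ q ℚᵘ.+ ℚ.toℚᵘ 1ℚ) (toℚ≡mkℚ n)) ⟨
  ℚ.toℚᵘ (toℚ n) ℚᵘ.+ ℚ.toℚᵘ 1ℚ              ≈⟨ ℚₚ.toℚᵘ-homo-+ (toℚ n) 1ℚ ⟨
  ℚ.toℚᵘ (toℚ n + 1ℚ)                        ∎)
  where
  open ℚᵘₚ.≃-Reasoning
  n+1≡1+n : ℤ.+ suc n ≡ ℤ.+ n ℤ.* ℤ.+ 1 ℤ.+ ℤ.+ 1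
  n+1≡1+n = sym (trans (cong (ℤ._+ ℤ.+ 1) (ℤₚ.*-identityʳ (ℤ.+ n))) (ℤₚ.+-comm (ℤ.+ n) (ℤ.+ 1)))

toℚ-nonneg : ∀ n → 0ℚ ≤ toℚ n
toℚ-nonneg n = subst (0ℚ ≤_) (sym (toℚ≡mkℚ n)) (ℚₚ.nonNegative⁻¹ _)

ℚ-ring : AlmostCommutativeRing 0ℓ 0ℓ
ℚ-ring = fromCommutativeRing ℚₚ.+-*-commutativeRing (λ q → dec⇒maybe (0ℚ ℚₚ.≟ q))

+-cancelˡ-≤ : ∀ x {a b} → x + a ≤ x + b → a ≤ b
+-cancelˡ-≤ x {a} {b} x+a≤x+b = begin
  a                 ≡⟨ -x+[x+y]≡y x a ⟨
  ℚ.- x + (x + a)   ≤⟨ ℚₚ.+-monoʳ-≤ (ℚ.- x) x+a≤x+b ⟩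
  ℚ.- x + (x + b)   ≡⟨ -x+[x+y]≡y x b ⟩
  b                 ∎
  where
  open ℚₚ.≤-Reasoning
  -x+[x+y]≡y : ∀ x y → ℚ.- x + (x + y) ≡ y
  -x+[x+y]≡y = solve-∀ ℚ-ring

≤-transfer : ∀ {x y a b e} → x ≤ y + e → y + a ≡ x + b → a ≤ b + e
≤-transfer {x} {y} {a} {b} {e} x≤y+e y+a≡x+b = +-cancelˡ-≤ x (begin
  x + a          ≤⟨ ℚₚ.+-monoˡ-≤ a x≤y+e ⟩
  (y + e) + a    ≡⟨ rearrange y e a ⟩
  (y + a) + e    ≡⟨ cong (_+ e) y+a≡x+b ⟩
  (x + b) + e    ≡⟨ ℚₚ.+-assoc x b e ⟩
  x + (b + e)    ∎)
  where
  open ℚₚ.≤-Reasoning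
  rearrange : ∀ y e a → (y + e) + a ≡ (y + a) + e
  rearrange = solve-∀ ℚ-ring

≤-half : ∀ {x y e M} → x ≤ y + e → x + y ≡ M → x ≤ (M + e) * ½
≤-half {x} {y} {e} {M} x≤y+e x+y≡M = begin
  x              ≡⟨ double-half x ⟩
  (x + x) * ½    ≤⟨ ℚₚ.*-monoʳ-≤-nonNeg ½ (ℚₚ.+-monoʳ-≤ x x≤y+e) ⟩
  (x + (y + e)) * ½ ≡⟨ cong (_* ½) (trans (sym (ℚₚ.+-assoc x y e)) (cong (_+ e) x+y≡M)) ⟩
  (M + e) * ½    ∎
  where
  open ℚₚ.≤-Reasoning
  double-half : ∀ x → x ≡ (x + x) * ½
  double-half = solve-∀ ℚ-ring

≤-slack-of-minimal : ∀ {ε p q x y c} → 0ℚ ≤ ε → ε * p + x ≤ ε * q + y → q ≤ p + c → x ≤ y + ε * c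
≤-slack-of-minimal {ε} {p} {q} {x} {y} {c} ε≥0 minimal q≤p+c = +-cancelˡ-≤ (ε * p) (begin
  ε * p + x          ≤⟨ minimal ⟩
  ε * q + y          ≤⟨ ℚₚ.+-monoˡ-≤ y (ℚₚ.*-monoˡ-≤-nonNeg ε {{ℚ.nonNegative ε≥0}} q≤p+c) ⟩
  ε * (p + c) + y    ≡⟨ rearrange ε p c y ⟩
  ε * p + (y + ε * c) ∎)
  where
  open ℚₚ.≤-Reasoning
  rearrange : ∀ ε p c y → ε * (p + c) + y ≡ ε * p + (y + ε * c)
  rearrange = solve-∀ ℚ-ring

inv-nonneg : ∀ c (c>0 : 0ℚ < c) → 0ℚ ≤ inv c c>0
inv-nonneg c c>0 = ℚₚ.<⇒≤ (ℚₚ.positive⁻¹ _ {{ℚₚ.1/pos⇒pos c {{ℚ.positive c>0}}}})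

≤-inv* : ∀ c (c>0 : 0ℚ < c) {x y} → c * x ≤ y → x ≤ inv c c>0 * y
≤-inv* c c>0 {x} {y} cx≤y = begin
  x                  ≡⟨ ℚₚ.*-identityˡ x ⟨
  1ℚ * x             ≡⟨ cong (_* x) (ℚₚ.*-inverseˡ c {{ℚₚ.pos⇒nonZero c {{ℚ.positive c>0}}}}) ⟨
  (inv c c>0 * c) * x ≡⟨ ℚₚ.*-assoc (inv c c>0) c x ⟩
  inv c c>0 * (c * x) ≤⟨ ℚₚ.*-monoˡ-≤-nonNeg (inv c c>0) {{ℚ.nonNegative (inv-nonneg c c>0)}} cx≤y ⟩
  inv c c>0 * y      ∎
  where open ℚₚ.≤-Reasoning

p+q≤r⇒p≤r : ∀ {p q r} → 0ℚ ≤ q → p + q ≤ r → p ≤ r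
p+q≤r⇒p≤r {p} {q} {r} q≥0 p+q≤r = begin
  p       ≡⟨ ℚₚ.+-identityʳ p ⟨
  p + 0ℚ  ≤⟨ ℚₚ.+-monoʳ-≤ p q≥0 ⟩
  p + q   ≤⟨ p+q≤r ⟩
  r       ∎
  where open ℚₚ.≤-Reasoning

p+q≤r⇒q≤r : ∀ {p q r} → 0ℚ ≤ p → p + q ≤ r → q ≤ r
p+q≤r⇒q≤r {p} {q} p≥0 p+q≤r = p+q≤r⇒p≤r p≥0 (subst (_≤ _) (ℚₚ.+-comm p q) p+q≤r)

*-nonneg : ∀ {p q} → 0ℚ ≤ p → 0ℚ ≤ q → 0ℚ ≤ p * q
*-nonneg {p} {q} p≥0 q≥0 =
  ℚₚ.nonNegative⁻¹ _ {{ℚₚ.nonNeg*nonNeg⇒nonNeg p {{ℚ.nonNegative p≥0}} q {{ℚ.nonNegative q≥0}}}}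

≤-foldr-⊔ : ∀ b (xs : List ℚ) → b ≤ foldr _⊔_ b xs
≤-foldr-⊔ b []       = ℚₚ.≤-refl
≤-foldr-⊔ b (x ∷ xs) = ℚₚ.p≤q⇒p≤r⊔q x (≤-foldr-⊔ b xs)

∈⇒≤-foldr-⊔ : ∀ b {xs : List ℚ} {x} → x ∈ xs → x ≤ foldr _⊔_ b xs
∈⇒≤-foldr-⊔ b {x ∷ xs} (here refl) = ℚₚ.p≤p⊔q x (foldr _⊔_ b xs)
∈⇒≤-foldr-⊔ b {y ∷ xs} (there x∈xs) = ℚₚ.p≤q⇒p≤r⊔q y (∈⇒≤-foldr-⊔ b x∈xs)

foldr-⊓-≤ : ∀ b (xs : List ℚ) → foldr _⊓_ b xs ≤ b
foldr-⊓-≤ b []       = ℚₚ.≤-refl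
foldr-⊓-≤ b (x ∷ xs) = ℚₚ.p≤q⇒r⊓p≤q x (foldr-⊓-≤ b xs)

∈⇒foldr-⊓-≤ : ∀ b {xs : List ℚ} {x} → x ∈ xs → foldr _⊓_ b xs ≤ x
∈⇒foldr-⊓-≤ b {x ∷ xs} (here refl) = ℚₚ.p⊓q≤p x (foldr _⊓_ b xs)
∈⇒foldr-⊓-≤ b {y ∷ xs} (there x∈xs) = ℚₚ.p≤q⇒r⊓p≤q y (∈⇒foldr-⊓-≤ b x∈xs)

module _ {n} (ε : ℚ) (εpos : 0ℚ < ε) (C : Fin n → ℚ) (Cpos : ∀ i → 0ℚ < C i) where

  [1+i]/Cᵢ : Fin n → ℚ
  [1+i]/Cᵢ i = toℚ (suc (toℕ i)) * inv (C i) (Cpos i)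

  inv-ε≤μ : inv ε εpos ≤ μconst n ε εpos C Cpos
  inv-ε≤μ = ≤-foldr-⊔ (inv ε εpos) (map [1+i]/Cᵢ (allFin n))

  [1+i]/Cᵢ≤μ : ∀ i → [1+i]/Cᵢ i ≤ μconst n ε εpos C Cpos
  [1+i]/Cᵢ≤μ i = ∈⇒≤-foldr-⊔ (inv ε εpos) (∈-map⁺ [1+i]/Cᵢ (∈-allFin i))

  μ-nonneg : 0ℚ ≤ μconst n ε εpos C Cpos
  μ-nonneg = ℚₚ.≤-trans (inv-nonneg ε εpos) inv-ε≤μ

ν≤C : ∀ {n} (C : Fin n → ℚ) i → νconst n C ≤ C i
ν≤C {suc n} C zero    = foldr-⊓-≤ (C zero) (map (C ∘ suc) (allFin n))
ν≤C {suc n} C (suc i) = ∈⇒foldr-⊓-≤ (C zero) (∈-map⁺ (C ∘ suc) (∈-allFin i))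

-- Norms and the local move

cellᵇ-sound : ∀ {N} (P : Simplex N → Bool) s σ → T (cellᵇ P s σ) → T (P σ) × card σ ≡ s
cellᵇ-sound P s σ t = proj₁ parts , ℕₚ.≡ᵇ⇒≡ (card σ) s (proj₂ parts)
  where
  parts : T (P σ) × T (card σ ≡ᵇ s)
  parts = Equivalence.to T-∧ t

cellᵇ-complete : ∀ {N} (P : Simplex N → Bool) s σ → T (P σ) → card σ ≡ s → cellᵇ P s σ ≡ true
cellᵇ-complete P s σ σ∈P card≡ = Equivalence.to T-≡ (Equivalence.from T-∧ (σ∈P , ℕₚ.≡⇒≡ᵇ (card σ) s card≡))

module _ {N} (P : Simplex N → Bool) (m : Simplex N → ℚ) where

  norm-cong : ∀ {s φ ψ} → AgreeOn P s φ ψ → norm P m s φ ≡ norm P m s ψ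
  norm-cong {s} {φ} {ψ} φ≈ψ = ∑-cong (allSimplices N) (λ σ → ind-∧-cong (cellᵇ P s σ) (m σ) (agree σ))
    where
    agree : ∀ σ → T (cellᵇ P s σ) → φ σ ≡ ψ σ
    agree σ t = φ≈ψ σ (proj₁ (cellᵇ-sound P s σ t)) (proj₂ (cellᵇ-sound P s σ t))

  norm-vanishing : ∀ {s φ} → AgreeOn P s φ 0ᶜ → norm P m s φ ≡ 0ℚ
  norm-vanishing {s} φ≈0 = trans (norm-cong φ≈0)
    (∑-vanish (allSimplices N) (λ σ → cong (λ b → ind b (m σ)) (∧-zeroʳ (cellᵇ P s σ))))

  norm-pos⇒Nonzero : ∀ {s φ} → 0ℚ < norm P m s φ → Nonzero P s φ
  norm-pos⇒Nonzero {s} {φ} norm>0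
    with ∑-pos (allSimplices N) (λ σ → ind (cellᵇ P s σ ∧ φ σ) (m σ)) norm>0
  ... | σ , term>0 with Equivalence.to T-∧ (ind-pos (cellᵇ P s σ ∧ φ σ) term>0)
  ... | σ-cell , φσ =
    σ , proj₁ (cellᵇ-sound P s σ σ-cell) , proj₂ (cellᵇ-sound P s σ σ-cell) , Equivalence.to T-≡ φσ

card-∪ : ∀ {N} (τ σ : Simplex N) → disjointᵇ τ σ ≡ true → card (τ ∪ₛ σ) ≡ card τ ℕ.+ card σ
card-∪ []          []          _ = refl
card-∪ (true ∷ τ)  (false ∷ σ) e = cong suc (card-∪ τ σ e)
card-∪ (false ∷ τ) (true ∷ σ)  e = trans (cong suc (card-∪ τ σ e)) (sym (ℕₚ.+-suc (card τ) (card σ)))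
card-∪ (false ∷ τ) (false ∷ σ) e = card-∪ τ σ e

≡ᵇ-+ˡ : ∀ c a b → (c ℕ.+ a ≡ᵇ c ℕ.+ b) ≡ (a ≡ᵇ b)
≡ᵇ-+ˡ zero    a b = refl
≡ᵇ-+ˡ (suc c) a b = ≡ᵇ-+ˡ c a b

module _ {N} (X : Complex N) (m : Simplex N → ℚ) where

  starNorm offStarNorm : Simplex N → ℕ → Cochain N → ℚ
  starNorm    τ c φ = norm (face X) m c (λ ρ → (τ ⊆ᵇ ρ) ∧ φ ρ)
  offStarNorm τ c φ = norm (face X) m c (λ ρ → not (τ ⊆ᵇ ρ) ∧ φ ρ)

  norm-star-split : ∀ τ c φ → norm (face X) m c φ ≡ starNorm τ c φ + offStarNorm τ c φ
  norm-star-split τ c φ =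
    trans (∑-cong (allSimplices N) (λ ρ → ind-∧-split (cellᵇ (face X) c ρ) (τ ⊆ᵇ ρ) (φ ρ) (m ρ)))
          (∑-+ (allSimplices N) (λ ρ → ind (cellᵇ (face X) c ρ ∧ ((τ ⊆ᵇ ρ) ∧ φ ρ)) (m ρ))
                                (λ ρ → ind (cellᵇ (face X) c ρ ∧ (not (τ ⊆ᵇ ρ) ∧ φ ρ)) (m ρ)))

  link-norm≡starNorm : ∀ τ s φ → norm (linkᵇ X τ) (m ∘ (τ ∪ₛ_)) s (φ ∘ (τ ∪ₛ_)) ≡ starNorm τ (card τ ℕ.+ s) φ
  link-norm≡starNorm τ s φ = begin
    norm (linkᵇ X τ) (m ∘ (τ ∪ₛ_)) s (φ ∘ (τ ∪ₛ_))  ≡⟨ ∑-cong (allSimplices N) link-term ⟩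
    ∑ₛ (λ σ → ind (disjointᵇ τ σ) (term (τ ∪ₛ σ)))  ≡⟨ ∑ₛ-∪-reindex τ term ⟩
    ∑ₛ (λ ρ → ind (τ ⊆ᵇ ρ) (term ρ))                ≡⟨ ∑-cong (allSimplices N) (λ ρ → ind-ind (τ ⊆ᵇ ρ) (cellᵇ (face X) c ρ) (φ ρ) (m ρ)) ⟩
    starNorm τ c φ                                  ∎
    where
    open ≡-Reasoning
    c : ℕ
    c = card τ ℕ.+ s
    term : Simplex N → ℚ
    term ρ = ind (cellᵇ (face X) c ρ ∧ φ ρ) (m ρ)
    link-term : ∀ σ → ind (cellᵇ (linkᵇ X τ) s σ ∧ φ (τ ∪ₛ σ)) (m (τ ∪ₛ σ)) ≡ ind (disjointᵇ τ σ) (term (τ ∪ₛ σ))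
    link-term σ with disjointᵇ τ σ in disjoint
    ... | false = refl
    ... | true rewrite card-∪ τ σ disjoint | ≡ᵇ-+ˡ (card τ) (card σ) s = refl

  local-move : ∀ τ s φ ψ →
    norm (face X) m (card τ ℕ.+ s) (φ +ᶜ d (lift τ ψ)) + norm (linkᵇ X τ) (m ∘ (τ ∪ₛ_)) s (φ ∘ (τ ∪ₛ_))
      ≡ norm (face X) m (card τ ℕ.+ s) φ + norm (linkᵇ X τ) (m ∘ (τ ∪ₛ_)) s ((φ ∘ (τ ∪ₛ_)) +ᶜ d ψ)
  local-move τ s φ ψ = begin
    norm (face X) m c φ′ + norm L mτ s (φ ∘ (τ ∪ₛ_))
      ≡⟨ cong₂ _+_ (norm-star-split τ c φ′) (link-norm≡starNorm τ s φ) ⟩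
    (starNorm τ c φ′ + offStarNorm τ c φ′) + starNorm τ c φ
      ≡⟨ cong (λ o → (starNorm τ c φ′ + o) + starNorm τ c φ) (∑-cong (allSimplices N) off-unchanged) ⟩
    (starNorm τ c φ′ + offStarNorm τ c φ) + starNorm τ c φ
      ≡⟨ swap (starNorm τ c φ′) (offStarNorm τ c φ) (starNorm τ c φ) ⟩
    (starNorm τ c φ + offStarNorm τ c φ) + starNorm τ c φ′
      ≡⟨ cong₂ _+_ (sym (norm-star-split τ c φ)) (trans (sym (link-norm≡starNorm τ s φ′)) (norm-cong L mτ on-link)) ⟩
    norm (face X) m c φ + norm L mτ s ((φ ∘ (τ ∪ₛ_)) +ᶜ d ψ) ∎
    where
    open ≡-Reasoning
    c : ℕ
    c = card τ ℕ.+ s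
    L : Simplex N → Bool
    L = linkᵇ X τ
    mτ : Simplex N → ℚ
    mτ = m ∘ (τ ∪ₛ_)
    φ′ : Cochain N
    φ′ = φ +ᶜ d (lift τ ψ)
    swap : ∀ a o b → (a + o) + b ≡ (b + o) + a
    swap = solve-∀ ℚ-ring
    off-unchanged : ∀ ρ → ind (cellᵇ (face X) c ρ ∧ (not (τ ⊆ᵇ ρ) ∧ φ′ ρ)) (m ρ)
                        ≡ ind (cellᵇ (face X) c ρ ∧ (not (τ ⊆ᵇ ρ) ∧ φ ρ)) (m ρ)
    off-unchanged ρ with τ ⊆ᵇ ρ in τ⊈ρ
    ... | true  = refl
    ... | false = cong (λ b → ind (cellᵇ (face X) c ρ ∧ b) (m ρ))
                       (trans (cong (φ ρ xor_) (d-lift-off τ ρ ψ τ⊈ρ)) (xor-identityʳ (φ ρ)))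
    on-link : AgreeOn L s (φ′ ∘ (τ ∪ₛ_)) ((φ ∘ (τ ∪ₛ_)) +ᶜ d ψ)
    on-link σ σ∈L _ = cong (φ (τ ∪ₛ σ) xor_) (d-lift-∪ τ σ ψ (Equivalence.to T-≡ (proj₁ (Equivalence.to T-∧ σ∈L))))

⊆ᵇ-refl : ∀ {N} (τ : Simplex N) → (τ ⊆ᵇ τ) ≡ true
⊆ᵇ-refl []          = refl
⊆ᵇ-refl (true ∷ τ)  = ⊆ᵇ-refl τ
⊆ᵇ-refl (false ∷ τ) = ⊆ᵇ-refl τ

⊆ᵇ⇒card-≤ : ∀ {N} (τ ρ : Simplex N) → (τ ⊆ᵇ ρ) ≡ true → card τ ℕ.≤ card ρ
⊆ᵇ⇒card-≤ []          []          _ = ℕ.z≤n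
⊆ᵇ⇒card-≤ (true ∷ τ)  (true ∷ ρ)  e = ℕ.s≤s (⊆ᵇ⇒card-≤ τ ρ e)
⊆ᵇ⇒card-≤ (false ∷ τ) (true ∷ ρ)  e = ℕₚ.m≤n⇒m≤1+n (⊆ᵇ⇒card-≤ τ ρ e)
⊆ᵇ⇒card-≤ (false ∷ τ) (false ∷ ρ) e = ⊆ᵇ⇒card-≤ τ ρ e

⊆ᵇ-card-≡⇒≡ : ∀ {N} (τ ρ : Simplex N) → (τ ⊆ᵇ ρ) ≡ true → card ρ ≡ card τ → ρ ≡ τ
⊆ᵇ-card-≡⇒≡ []          []          _ _ = refl
⊆ᵇ-card-≡⇒≡ (true ∷ τ)  (true ∷ ρ)  e c = cong (true ∷_) (⊆ᵇ-card-≡⇒≡ τ ρ e (ℕₚ.suc-injective c))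
⊆ᵇ-card-≡⇒≡ (false ∷ τ) (true ∷ ρ)  e c = ⊥-elim (ℕₚ.<-irrefl (sym c) (ℕ.s≤s (⊆ᵇ⇒card-≤ τ ρ e)))
⊆ᵇ-card-≡⇒≡ (false ∷ τ) (false ∷ ρ) e c = cong (false ∷_) (⊆ᵇ-card-≡⇒≡ τ ρ e c)

facet-between : ∀ {N} (τ ρ : Simplex N) → (τ ⊆ᵇ ρ) ≡ true → card τ ℕ.< card ρ →
  Σ (Simplex N) λ ρ′ → (τ ⊆ᵇ ρ′) ≡ true × (ρ′ ⊆ᵇ ρ) ≡ true × suc (card ρ′) ≡ card ρ
facet-between (true ∷ τ) (true ∷ ρ) e (ℕ.s≤s τ<ρ) with facet-between τ ρ e τ<ρ
... | ρ′ , τ⊆ρ′ , ρ′⊆ρ , card≡ = true ∷ ρ′ , τ⊆ρ′ , ρ′⊆ρ , cong suc card≡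
facet-between (false ∷ τ) (true ∷ ρ) e _ = false ∷ ρ , e , ⊆ᵇ-refl ρ , refl
facet-between (false ∷ τ) (false ∷ ρ) e τ<ρ with facet-between τ ρ e τ<ρ
... | ρ′ , τ⊆ρ′ , ρ′⊆ρ , card≡ = false ∷ ρ′ , τ⊆ρ′ , ρ′⊆ρ , card≡

subsetCount : ∀ {N} → Simplex N → ℕ → ℚ
subsetCount ρ c = ∑ₛ (λ τ → ind ((τ ⊆ᵇ ρ) ∧ (card τ ≡ᵇ c)) 1ℚ)

subsetCount-false∷ : ∀ {N} (ρ : Simplex N) c → subsetCount (false ∷ ρ) c ≡ subsetCount ρ c
subsetCount-false∷ {N} ρ c = trans (∑ₛ-∷ (λ τ → ind ((τ ⊆ᵇ (false ∷ ρ)) ∧ (card τ ≡ᵇ c)) 1ℚ))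
  (trans (cong (_+ subsetCount ρ c) (∑-vanish (allSimplices N) (λ _ → refl))) (ℚₚ.+-identityˡ _))

subsetCount-true∷-zero : ∀ {N} (ρ : Simplex N) → subsetCount (true ∷ ρ) 0 ≡ subsetCount ρ 0
subsetCount-true∷-zero {N} ρ = trans (∑ₛ-∷ (λ τ → ind ((τ ⊆ᵇ (true ∷ ρ)) ∧ (card τ ≡ᵇ 0)) 1ℚ))
  (trans (cong (_+ subsetCount ρ 0) (∑-vanish (allSimplices N) (λ τ → cong (λ b → ind b 1ℚ) (∧-zeroʳ (τ ⊆ᵇ ρ)))))
         (ℚₚ.+-identityˡ _))

subsetCount-true∷-suc : ∀ {N} (ρ : Simplex N) c →
  subsetCount (true ∷ ρ) (suc c) ≡ subsetCount ρ c + subsetCount ρ (suc c)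
subsetCount-true∷-suc ρ c = ∑ₛ-∷ (λ τ → ind ((τ ⊆ᵇ (true ∷ ρ)) ∧ (card τ ≡ᵇ suc c)) 1ℚ)

subsetCount-above : ∀ {N} (ρ : Simplex N) c → card ρ ℕ.< c → subsetCount ρ c ≡ 0ℚ
subsetCount-above []          (suc c) _         = refl
subsetCount-above (true ∷ ρ)  (suc c) (ℕ.s≤s p) = trans (subsetCount-true∷-suc ρ c)
  (cong₂ _+_ (subsetCount-above ρ c p) (subsetCount-above ρ (suc c) (ℕₚ.m≤n⇒m≤1+n p)))
subsetCount-above (false ∷ ρ) c       p         = trans (subsetCount-false∷ ρ c) (subsetCount-above ρ c p)

subsetCount-card : ∀ {N} (ρ : Simplex N) → subsetCount ρ (card ρ) ≡ 1ℚ
subsetCount-card []          = refl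
subsetCount-card (true ∷ ρ)  = trans (subsetCount-true∷-suc ρ (card ρ))
  (trans (cong₂ _+_ (subsetCount-card ρ) (subsetCount-above ρ (suc (card ρ)) ℕₚ.≤-refl)) (ℚₚ.+-identityʳ 1ℚ))
subsetCount-card (false ∷ ρ) = trans (subsetCount-false∷ ρ (card ρ)) (subsetCount-card ρ)

subsetCount-facets : ∀ {N} (ρ : Simplex N) c → card ρ ≡ suc c → subsetCount ρ c ≡ toℚ (suc c)
subsetCount-facets (true ∷ ρ) zero e =
  trans (subsetCount-true∷-zero ρ) (subst (λ c → subsetCount ρ c ≡ 1ℚ) (ℕₚ.suc-injective e) (subsetCount-card ρ))
subsetCount-facets (true ∷ ρ) (suc c) e = begin
  subsetCount (true ∷ ρ) (suc c)             ≡⟨ subsetCount-true∷-suc ρ c ⟩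
  subsetCount ρ c + subsetCount ρ (suc c)    ≡⟨ cong₂ _+_ (subsetCount-facets ρ c card≡) (subst (λ c → subsetCount ρ c ≡ 1ℚ) card≡ (subsetCount-card ρ)) ⟩
  toℚ (suc c) + 1ℚ                           ≡⟨ toℚ-suc (suc c) ⟨
  toℚ (suc (suc c))                          ∎
  where
  open ≡-Reasoning
  card≡ : card ρ ≡ suc c
  card≡ = ℕₚ.suc-injective e
subsetCount-facets (false ∷ ρ) c e = trans (subsetCount-false∷ ρ c) (subsetCount-facets ρ c e)

-- Minimisation over cochains

Bool-minimiser : (h : Bool → ℚ) → Σ Bool λ b₀ → ∀ b → h b₀ ≤ h b
Bool-minimiser h with ℚₚ.≤-total (h true) (h false)
... | inj₁ t≤f = true  , λ { true → ℚₚ.≤-refl ; false → t≤f }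
... | inj₂ f≤t = false , λ { true → f≤t ; false → ℚₚ.≤-refl }

Extensional : ∀ {N} → (Cochain N → ℚ) → Set
Extensional H = ∀ {f g} → f ≗ g → H f ≡ H g

join : ∀ {N} → Cochain N → Cochain N → Cochain (suc N)
join g₁ g₂ (true ∷ σ)  = g₁ σ
join g₁ g₂ (false ∷ σ) = g₂ σ

join-split : ∀ {N} (f : Cochain (suc N)) → join (f ∘ (true ∷_)) (f ∘ (false ∷_)) ≗ f
join-split f (true ∷ σ)  = refl
join-split f (false ∷ σ) = refl

join-cong : ∀ {N} {g₁ g₁′ g₂ g₂′ : Cochain N} → g₁ ≗ g₁′ → g₂ ≗ g₂′ → join g₁ g₂ ≗ join g₁′ g₂′
join-cong g₁≗ g₂≗ (true ∷ σ)  = g₁≗ σ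
join-cong g₁≗ g₂≗ (false ∷ σ) = g₂≗ σ

minimiser : ∀ {N} (H : Cochain N → ℚ) → Extensional H → Σ (Cochain N) λ g → ∀ f → H g ≤ H f
minimiser {zero} H H-ext with Bool-minimiser (λ b → H (λ _ → b))
... | b₀ , b₀-min = (λ _ → b₀) , λ f → ℚₚ.≤-trans (b₀-min (f [])) (ℚₚ.≤-reflexive (H-ext λ { [] → refl }))
minimiser {suc N} H H-ext = join g₁* (best g₁*) , optimal
  where
  best-for : ∀ g₁ → Σ (Cochain N) λ g₂ → ∀ f → H (join g₁ g₂) ≤ H (join g₁ f)
  best-for g₁ = minimiser (λ g₂ → H (join g₁ g₂)) (λ g₂≗ → H-ext (join-cong (λ _ → refl) g₂≗))
  best : Cochain N → Cochain N
  best g₁ = proj₁ (best-for g₁)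
  value : Cochain N → ℚ
  value g₁ = H (join g₁ (best g₁))
  value-≤ : ∀ {g₁ g₁′} → g₁ ≗ g₁′ → value g₁ ≤ value g₁′
  value-≤ {g₁} {g₁′} g₁≗ = ℚₚ.≤-trans (proj₂ (best-for g₁) (best g₁′))
                                      (ℚₚ.≤-reflexive (H-ext (join-cong g₁≗ (λ _ → refl))))
  outer : Σ (Cochain N) λ g₁ → ∀ f → value g₁ ≤ value f
  outer = minimiser value (λ g₁≗ → ℚₚ.≤-antisym (value-≤ g₁≗) (value-≤ (sym ∘ g₁≗)))
  g₁* : Cochain N
  g₁* = proj₁ outer
  optimal : ∀ f → H (join g₁* (best g₁*)) ≤ H f
  optimal f = begin
    value g₁*                                              ≤⟨ proj₂ outer (f ∘ (true ∷_)) ⟩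
    value (f ∘ (true ∷_))                                  ≤⟨ proj₂ (best-for (f ∘ (true ∷_))) (f ∘ (false ∷_)) ⟩
    H (join (f ∘ (true ∷_)) (f ∘ (false ∷_)))              ≡⟨ H-ext (join-split f) ⟩
    H f                                                    ∎
    where open ℚₚ.≤-Reasoning

SmallLocMinNotCocycle : ∀ {N} → Complex N → (n : ℕ) → (Simplex N → ℚ) → (Fin n → ℚ) → ℚ → Set
SmallLocMinNotCocycle {N} X n m C ε = ∀ (k : Fin n) (φ : Cochain N) →
  Nonzero (face X) (suc (toℕ k)) φ →
  LocMin X m ε (toℕ k) φ →
  norm (face X) m (suc (toℕ k)) φ ≤ C k * mass (face X) m (suc (toℕ k)) →
  0ℚ < norm (face X) m (suc (suc (toℕ k))) (d φ)

module Weighted {N} (X : Complex N) (n : ℕ) (m : Simplex N → ℚ) (weight : IsWeight X n m) where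

  -- ‖ φ ‖ s is the norm of φ on the cells with s vertices, i.e. in degree s - 1.
  infix 10 ‖_‖_
  ‖_‖_ : Cochain N → ℕ → ℚ
  ‖ φ ‖ s = norm (face X) m s φ

  m>0 : ∀ σ → T (face X σ) → 0ℚ < m σ
  m>0 = proj₁ weight

  starMass : Simplex N → ℕ → ℚ
  starMass τ c = ‖ τ ⊆ᵇ_ ‖ c

  balanced : ∀ τ → T (face X τ) → card τ ℕ.≤ n → m τ ≡ starMass τ (suc (card τ))
  balanced = proj₂ weight

  cell-nonneg : ∀ s σ → 0ℚ ≤ ind (cellᵇ (face X) s σ) (m σ)
  cell-nonneg s σ = ind-nonneg (cellᵇ (face X) s σ) (λ t → ℚₚ.<⇒≤ (m>0 σ (proj₁ (cellᵇ-sound (face X) s σ t))))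

  term-nonneg : ∀ s (φ : Cochain N) σ → 0ℚ ≤ ind (cellᵇ (face X) s σ ∧ φ σ) (m σ)
  term-nonneg s φ σ = ind-nonneg (cellᵇ (face X) s σ ∧ φ σ)
    (λ t → ℚₚ.<⇒≤ (m>0 σ (proj₁ (cellᵇ-sound (face X) s σ (proj₁ (Equivalence.to (T-∧ {cellᵇ (face X) s σ}) t))))))

  norm-nonneg : ∀ s φ → 0ℚ ≤ ‖ φ ‖ s
  norm-nonneg s φ = ∑-nonneg (allSimplices N) (term-nonneg s φ)

  mass-nonneg : ∀ s → 0ℚ ≤ mass (face X) m s
  mass-nonneg s = ∑-nonneg (allSimplices N) (cell-nonneg s)

  norm-≤-mass : ∀ s φ → ‖ φ ‖ s ≤ mass (face X) m s
  norm-≤-mass s φ = ∑-mono (allSimplices N) (λ σ → ind-∧-≤ (cellᵇ (face X) s σ) (φ σ) (cell-nonneg s σ))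

  norm-mono : ∀ s {φ ψ} → (∀ σ → φ σ ≡ true → ψ σ ≡ true) → ‖ φ ‖ s ≤ ‖ ψ ‖ s
  norm-mono s φ⊆ψ = ∑-mono (allSimplices N) (λ σ → ind-∧-mono (cellᵇ (face X) s σ) (φ⊆ψ σ) (cell-nonneg s σ))

  norm-+ᶜ : ∀ s φ ψ → ‖ φ +ᶜ ψ ‖ s ≤ ‖ φ ‖ s + ‖ ψ ‖ s
  norm-+ᶜ s φ ψ = ℚₚ.≤-trans
    (∑-mono (allSimplices N) (λ σ → ind-∧-xor (cellᵇ (face X) s σ) (φ σ) (ψ σ) (cell-nonneg s σ)))
    (ℚₚ.≤-reflexive (∑-+ (allSimplices N) (λ σ → ind (cellᵇ (face X) s σ ∧ φ σ) (m σ))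
                                          (λ σ → ind (cellᵇ (face X) s σ ∧ ψ σ) (m σ))))

  norm-+-norm-not : ∀ s φ → ‖ φ ‖ s + ‖ not ∘ φ ‖ s ≡ mass (face X) m s
  norm-+-norm-not s φ = trans
    (sym (∑-+ (allSimplices N) (λ σ → ind (cellᵇ (face X) s σ ∧ φ σ) (m σ))
                               (λ σ → ind (cellᵇ (face X) s σ ∧ not (φ σ)) (m σ))))
    (∑-cong (allSimplices N) (λ σ → ind-∧-not (cellᵇ (face X) s σ) (φ σ) (m σ)))

  Nonzero⇒norm-pos : ∀ s φ → Nonzero (face X) s φ → 0ℚ < ‖ φ ‖ s
  Nonzero⇒norm-pos s φ (σ , σ∈X , card≡ , φσ) = ℚₚ.<-≤-trans (m>0 σ σ∈X) (begin
    m σ                                     ≡⟨ term≡ ⟨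
    ind (cellᵇ (face X) s σ ∧ φ σ) (m σ)    ≤⟨ ∑ₛ-single (term-nonneg s φ) σ ⟩
    ‖ φ ‖ s                                 ∎)
    where
    open ℚₚ.≤-Reasoning
    term≡ : ind (cellᵇ (face X) s σ ∧ φ σ) (m σ) ≡ m σ
    term≡ rewrite cellᵇ-complete (face X) s σ σ∈X card≡ | φσ = refl

  Nonzero⊎Vanishes : ∀ s φ → Nonzero (face X) s φ ⊎ AgreeOn (face X) s φ 0ᶜ
  Nonzero⊎Vanishes s φ with 0ℚ ℚₚ.<? ‖ φ ‖ s
  ... | yes ‖φ‖>0 = inj₁ (norm-pos⇒Nonzero (face X) m ‖φ‖>0)
  ... | no  ‖φ‖≯0 = inj₂ vanishes
    where
    vanishes : AgreeOn (face X) s φ 0ᶜ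
    vanishes σ σ∈X card≡ with φ σ in φσ
    ... | false = refl
    ... | true  = ⊥-elim (‖φ‖≯0 (Nonzero⇒norm-pos s φ (σ , σ∈X , card≡ , φσ)))

  double-count : ∀ c (A : Cochain N) → c ℕ.≤ n →
    ‖ A ‖ c ≡ ∑ₛ (λ ρ → ∑ₛ (λ τ → ind (cellᵇ (face X) c τ ∧ A τ) (ind (cellᵇ (face X) (suc c) ρ ∧ (τ ⊆ᵇ ρ)) (m ρ))))
  double-count c A c≤n = begin
    ‖ A ‖ c
      ≡⟨ ∑-cong (allSimplices N) (λ τ → ind-cong (cellᵇ (face X) c τ ∧ A τ) (balanced-cell τ)) ⟩
    ∑ₛ (λ τ → ind (cellᵇ (face X) c τ ∧ A τ) (starMass τ (suc c)))
      ≡⟨ ∑-cong (allSimplices N) (λ τ → ind-∑ (cellᵇ (face X) c τ ∧ A τ) (allSimplices N) (term τ)) ⟩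
    ∑ₛ (λ τ → ∑ₛ (λ ρ → ind (cellᵇ (face X) c τ ∧ A τ) (term τ ρ)))
      ≡⟨ ∑-swap (allSimplices N) (allSimplices N) (λ τ ρ → ind (cellᵇ (face X) c τ ∧ A τ) (term τ ρ)) ⟩
    ∑ₛ (λ ρ → ∑ₛ (λ τ → ind (cellᵇ (face X) c τ ∧ A τ) (term τ ρ))) ∎
    where
    open ≡-Reasoning
    term : Simplex N → Simplex N → ℚ
    term τ ρ = ind (cellᵇ (face X) (suc c) ρ ∧ (τ ⊆ᵇ ρ)) (m ρ)
    balanced-cell : ∀ τ → T (cellᵇ (face X) c τ ∧ A τ) → m τ ≡ starMass τ (suc c)
    balanced-cell τ t with cellᵇ-sound (face X) c τ (proj₁ (Equivalence.to (T-∧ {cellᵇ (face X) c τ}) t))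
    ... | τ∈X , refl = balanced τ τ∈X c≤n

  starMass-card : ∀ τ → T (face X τ) → starMass τ (card τ) ≡ m τ
  starMass-card τ τ∈X = trans (∑ₛ-point (λ ρ → ind (cellᵇ (face X) (card τ) ρ ∧ (τ ⊆ᵇ ρ)) (m ρ)) τ off-τ) at-τ
    where
    at-τ : ind (cellᵇ (face X) (card τ) τ ∧ (τ ⊆ᵇ τ)) (m τ) ≡ m τ
    at-τ rewrite cellᵇ-complete (face X) (card τ) τ τ∈X refl | ⊆ᵇ-refl τ = refl
    off-τ : ∀ ρ → ρ ≢ τ → ind (cellᵇ (face X) (card τ) ρ ∧ (τ ⊆ᵇ ρ)) (m ρ) ≡ 0ℚ
    off-τ ρ ρ≢τ with cellᵇ (face X) (card τ) ρ in ρ-cell | τ ⊆ᵇ ρ in τ⊆ρ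
    ... | false | _     = refl
    ... | true  | false = refl
    ... | true  | true  = ⊥-elim (ρ≢τ (⊆ᵇ-card-≡⇒≡ τ ρ τ⊆ρ card≡))
      where
      card≡ : card ρ ≡ card τ
      card≡ = proj₂ (cellᵇ-sound (face X) (card τ) ρ (Equivalence.from T-≡ ρ-cell))

  starMass-step : ∀ τ c → card τ ℕ.≤ c → c ℕ.≤ n → starMass τ (suc c) ≤ starMass τ c
  starMass-step τ c τ≤c c≤n =
    ℚₚ.≤-trans (∑-mono (allSimplices N) star-term) (ℚₚ.≤-reflexive (sym (double-count c (τ ⊆ᵇ_) c≤n)))
    where
    inner : Simplex N → Simplex N → ℚ
    inner ρ τ′ = ind (cellᵇ (face X) c τ′ ∧ (τ ⊆ᵇ τ′)) (ind (cellᵇ (face X) (suc c) ρ ∧ (τ′ ⊆ᵇ ρ)) (m ρ))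
    inner-nonneg : ∀ ρ τ′ → 0ℚ ≤ inner ρ τ′
    inner-nonneg ρ τ′ = ind-nonneg (cellᵇ (face X) c τ′ ∧ (τ ⊆ᵇ τ′)) (λ _ → term-nonneg (suc c) (τ′ ⊆ᵇ_) ρ)
    star-term : ∀ ρ → ind (cellᵇ (face X) (suc c) ρ ∧ (τ ⊆ᵇ ρ)) (m ρ) ≤ ∑ₛ (inner ρ)
    star-term ρ = ind-≤ (cellᵇ (face X) (suc c) ρ ∧ (τ ⊆ᵇ ρ)) (∑-nonneg (allSimplices N) (inner-nonneg ρ)) in-star
      where
      in-star : T (cellᵇ (face X) (suc c) ρ ∧ (τ ⊆ᵇ ρ)) → m ρ ≤ ∑ₛ (inner ρ)
      in-star t with Equivalence.to (T-∧ {cellᵇ (face X) (suc c) ρ}) t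
      ... | ρ-cell , τ⊆ρ with cellᵇ-sound (face X) (suc c) ρ ρ-cell
      ... | ρ∈X , card-ρ with facet-between τ ρ (Equivalence.to T-≡ τ⊆ρ) (subst (card τ ℕ.<_) (sym card-ρ) (ℕ.s≤s τ≤c))
      ... | ρ′ , τ⊆ρ′ , ρ′⊆ρ , card-ρ′ = ℚₚ.≤-trans (ℚₚ.≤-reflexive (sym at-ρ′)) (∑ₛ-single (inner-nonneg ρ) ρ′)
        where
        at-ρ′ : inner ρ ρ′ ≡ m ρ
        at-ρ′ rewrite cellᵇ-complete (face X) c ρ′ (down X ρ ρ′ (Equivalence.from T-≡ ρ′⊆ρ) ρ∈X)
                                     (ℕₚ.suc-injective (trans card-ρ′ card-ρ))
                    | τ⊆ρ′ | Equivalence.to T-≡ ρ-cell | ρ′⊆ρ = refl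

  starMass-≤ : ∀ τ → T (face X τ) → ∀ c → card τ ℕ.≤ c → c ℕ.≤ suc n → starMass τ c ≤ m τ
  starMass-≤ τ τ∈X c τ≤c c≤1+n with ℕₚ.m≤n⇒m<n∨m≡n τ≤c
  ... | inj₂ refl = ℚₚ.≤-reflexive (starMass-card τ τ∈X)
  starMass-≤ τ τ∈X (suc c) τ≤1+c c≤1+n | inj₁ (ℕ.s≤s τ≤c) = ℚₚ.≤-trans
    (starMass-step τ c τ≤c (ℕₚ.≤-pred c≤1+n))
    (starMass-≤ τ τ∈X c τ≤c (ℕₚ.m≤n⇒m≤1+n (ℕₚ.≤-pred c≤1+n)))

  norm-star-≤ : ∀ τ → T (face X τ) → ∀ c → card τ ℕ.≤ c → c ℕ.≤ suc n →
    ∀ χ → (∀ ρ → χ ρ ≡ true → (τ ⊆ᵇ ρ) ≡ true) → ‖ χ ‖ c ≤ m τ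
  norm-star-≤ τ τ∈X c τ≤c c≤1+n χ χ-in-star =
    ℚₚ.≤-trans (norm-mono c χ-in-star) (starMass-≤ τ τ∈X c τ≤c c≤1+n)

  mass-≤-suc : ∀ c → c ℕ.≤ n → mass (face X) m c ≤ toℚ (suc c) * mass (face X) m (suc c)
  mass-≤-suc c c≤n = begin
    mass (face X) m c
      ≡⟨ ∑-cong (allSimplices N) (λ τ → cong (λ b → ind b (m τ)) (sym (∧-identityʳ (cellᵇ (face X) c τ)))) ⟩
    ‖ (λ _ → true) ‖ c
      ≡⟨ double-count c (λ _ → true) c≤n ⟩
    ∑ₛ (λ ρ → ∑ₛ (λ τ → ind (cellᵇ (face X) c τ ∧ true) (ind (cellᵇ (face X) (suc c) ρ ∧ (τ ⊆ᵇ ρ)) (m ρ))))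
      ≤⟨ ∑-mono (allSimplices N) facets-term ⟩
    ∑ₛ (λ ρ → toℚ (suc c) * ind (cellᵇ (face X) (suc c) ρ) (m ρ))
      ≡⟨ ∑-*ˡ (allSimplices N) (toℚ (suc c)) (λ ρ → ind (cellᵇ (face X) (suc c) ρ) (m ρ)) ⟩
    toℚ (suc c) * mass (face X) m (suc c) ∎
    where
    open ℚₚ.≤-Reasoning
    facets-term : ∀ ρ → ∑ₛ (λ τ → ind (cellᵇ (face X) c τ ∧ true) (ind (cellᵇ (face X) (suc c) ρ ∧ (τ ⊆ᵇ ρ)) (m ρ)))
                          ≤ toℚ (suc c) * ind (cellᵇ (face X) (suc c) ρ) (m ρ)
    facets-term ρ with cellᵇ (face X) (suc c) ρ in ρ-cell
    ... | false = ℚₚ.≤-reflexive (trans (∑-vanish (allSimplices N) (λ τ → ind-0 (cellᵇ (face X) c τ ∧ true)))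
                                        (sym (ℚₚ.*-zeroʳ (toℚ (suc c)))))
    ... | true  with cellᵇ-sound (face X) (suc c) ρ (Equivalence.from T-≡ ρ-cell)
    ...   | ρ∈X , card-ρ = begin
      ∑ₛ (λ τ → ind (cellᵇ (face X) c τ ∧ true) (ind (τ ⊆ᵇ ρ) (m ρ)))
        ≤⟨ ∑-mono (allSimplices N) (λ τ → ind-∧-forget (face X τ) (card τ ≡ᵇ c) (τ ⊆ᵇ ρ) (ℚₚ.<⇒≤ (m>0 ρ ρ∈X))) ⟩
      ∑ₛ (λ τ → ind ((τ ⊆ᵇ ρ) ∧ (card τ ≡ᵇ c)) (m ρ))
        ≡⟨ ∑-cong (allSimplices N) (λ τ → ind-1* ((τ ⊆ᵇ ρ) ∧ (card τ ≡ᵇ c)) (m ρ)) ⟨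
      ∑ₛ (λ τ → ind ((τ ⊆ᵇ ρ) ∧ (card τ ≡ᵇ c)) 1ℚ * m ρ)
        ≡⟨ ∑-*ʳ (allSimplices N) (m ρ) (λ τ → ind ((τ ⊆ᵇ ρ) ∧ (card τ ≡ᵇ c)) 1ℚ) ⟩
      subsetCount ρ c * m ρ
        ≡⟨ cong (_* m ρ) (subsetCount-facets ρ c card-ρ) ⟩
      toℚ (suc c) * m ρ ∎

  AlmostMinimal : ℚ → ℕ → Cochain N → Set
  AlmostMinimal ε k φ = ∀ χ → ‖ φ ‖ suc k ≤ ‖ φ +ᶜ d χ ‖ suc k + ε * ‖ χ ‖ k

  almostMinimal⇒LocMin : ∀ {ε} k φ → 0ℚ ≤ ε → k ℕ.≤ n → AlmostMinimal ε k φ → LocMin X m ε k φ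
  almostMinimal⇒LocMin {ε} zero φ ε≥0 _ minimal = begin
    ‖ φ ‖ 1                                    ≤⟨ ≤-half flip-all (norm-+-norm-not 1 φ) ⟩
    (mass (face X) m 1 + ε * ‖ 1ᶜ ‖ 0) * ½     ≤⟨ ℚₚ.*-monoʳ-≤-nonNeg ½ (ℚₚ.+-monoʳ-≤ (mass (face X) m 1) (ℚₚ.*-monoˡ-≤-nonNeg ε {{ℚ.nonNegative ε≥0}} ‖1‖≤M)) ⟩
    (mass (face X) m 1 + ε * mass (face X) m 1) * ½ ≡⟨ cong (_* ½) (rearrange ε (mass (face X) m 1)) ⟩
    ((1ℚ + ε) * mass (face X) m 1) * ½         ∎
    where
    open ℚₚ.≤-Reasoning
    1ᶜ : Cochain N
    1ᶜ _ = true
    flip-all : ‖ φ ‖ 1 ≤ ‖ not ∘ φ ‖ 1 + ε * ‖ 1ᶜ ‖ 0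
    flip-all = subst (λ y → ‖ φ ‖ 1 ≤ y + ε * ‖ 1ᶜ ‖ 0)
      (norm-cong (face X) m (λ σ _ card≡1 → trans (cong (φ σ xor_) (d-vertex 1ᶜ σ card≡1)) (xor-true (φ σ))))
      (minimal 1ᶜ)
    ‖1‖≤M : ‖ 1ᶜ ‖ 0 ≤ mass (face X) m 1
    ‖1‖≤M = ℚₚ.≤-trans (norm-≤-mass 0 1ᶜ) (ℚₚ.≤-trans (mass-≤-suc 0 ℕ.z≤n) (ℚₚ.≤-reflexive (ℚₚ.*-identityˡ _)))
    rearrange : ∀ ε M → M + ε * M ≡ (1ℚ + ε) * M
    rearrange = solve-∀ ℚ-ring
  almostMinimal⇒LocMin {ε} (suc k) φ ε≥0 1+k≤n minimal j j≤k τ τ∈X card-τ ψ = begin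
    ‖φ_τ‖                       ≤⟨ ≤-transfer {y = ‖ φ +ᶜ d (lift τ ψ) ‖ suc (suc k)} (minimal (lift τ ψ)) local ⟩
    ‖φ_τ+dψ‖ + ε * ‖ lift τ ψ ‖ suc k ≤⟨ ℚₚ.+-monoʳ-≤ ‖φ_τ+dψ‖ (ℚₚ.*-monoˡ-≤-nonNeg ε {{ℚ.nonNegative ε≥0}} ‖lift‖≤mτ) ⟩
    ‖φ_τ+dψ‖ + ε * m τ          ∎
    where
    open ℚₚ.≤-Reasoning
    s : ℕ
    s = suc k ℕ.∸ j
    ‖φ_τ‖ ‖φ_τ+dψ‖ : ℚ
    ‖φ_τ‖    = norm (linkᵇ X τ) (m ∘ (τ ∪ₛ_)) s (φ ∘ (τ ∪ₛ_))
    ‖φ_τ+dψ‖ = norm (linkᵇ X τ) (m ∘ (τ ∪ₛ_)) s ((φ ∘ (τ ∪ₛ_)) +ᶜ d ψ)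
    card≡ : card τ ℕ.+ s ≡ suc (suc k)
    card≡ = trans (cong (ℕ._+ s) card-τ) (cong suc (ℕₚ.m+[n∸m]≡n (ℕₚ.m≤n⇒m≤1+n j≤k)))
    local : ‖ φ +ᶜ d (lift τ ψ) ‖ suc (suc k) + ‖φ_τ‖ ≡ ‖ φ ‖ suc (suc k) + ‖φ_τ+dψ‖
    local = subst (λ c → ‖ φ +ᶜ d (lift τ ψ) ‖ c + ‖φ_τ‖ ≡ ‖ φ ‖ c + ‖φ_τ+dψ‖) card≡ (local-move X m τ s φ ψ)
    ‖lift‖≤mτ : ‖ lift τ ψ ‖ suc k ≤ m τ
    ‖lift‖≤mτ = norm-star-≤ τ τ∈X (suc k) (subst (ℕ._≤ suc k) (sym card-τ) (ℕ.s≤s j≤k)) (ℕₚ.m≤n⇒m≤1+n 1+k≤n)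
                  (lift τ ψ) (lift-in-star τ ψ)

  fillingCost : ℚ → ℕ → Cochain N → Cochain N → ℚ
  fillingCost ε k φ ψ = ε * ‖ ψ ‖ k + ‖ φ +ᶜ d ψ ‖ suc k

  fillingCost-ext : ∀ ε k φ → Extensional (fillingCost ε k φ)
  fillingCost-ext ε k φ ψ≗ψ′ = cong₂ (λ a b → ε * a + b)
    (norm-cong (face X) m (λ σ _ _ → ψ≗ψ′ σ))
    (norm-cong (face X) m (λ σ _ _ → cong (φ σ xor_) (d-cong ψ≗ψ′ σ)))

  optimal-filling : ∀ {ε} → 0ℚ ≤ ε → ∀ k φ →
    Σ (Cochain N) λ ψ → AlmostMinimal ε k (φ +ᶜ d ψ) × fillingCost ε k φ ψ ≤ ‖ φ ‖ suc k
  optimal-filling {ε} ε≥0 k φ = ψ , almost-minimal , ℚₚ.≤-trans (ψ-optimal 0ᶜ) (ℚₚ.≤-reflexive cost-of-0)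
    where
    optimum : Σ (Cochain N) λ ψ → ∀ ψ′ → fillingCost ε k φ ψ ≤ fillingCost ε k φ ψ′
    optimum = minimiser (fillingCost ε k φ) (fillingCost-ext ε k φ)
    ψ : Cochain N
    ψ = proj₁ optimum
    ψ-optimal : ∀ ψ′ → fillingCost ε k φ ψ ≤ fillingCost ε k φ ψ′
    ψ-optimal = proj₂ optimum
    almost-minimal : AlmostMinimal ε k (φ +ᶜ d ψ)
    almost-minimal χ = ≤-slack-of-minimal ε≥0
      (ℚₚ.≤-trans (ψ-optimal (ψ +ᶜ χ)) (ℚₚ.≤-reflexive (cong (ε * ‖ ψ +ᶜ χ ‖ k +_) reassociate)))
      (norm-+ᶜ k ψ χ)
      where
      reassociate : ‖ φ +ᶜ d (ψ +ᶜ χ) ‖ suc k ≡ ‖ φ +ᶜ d ψ +ᶜ d χ ‖ suc k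
      reassociate = norm-cong (face X) m (λ σ _ _ →
        trans (cong (φ σ xor_) (d-+ᶜ ψ χ σ)) (sym (xor-assoc (φ σ) (d ψ σ) (d χ σ))))
    cost-of-0 : fillingCost ε k φ 0ᶜ ≡ ‖ φ ‖ suc k
    cost-of-0 = begin
      ε * ‖ 0ᶜ ‖ k + ‖ φ +ᶜ d 0ᶜ ‖ suc k
        ≡⟨ cong₂ (λ a b → ε * a + b) (norm-vanishing (face X) m (λ _ _ _ → refl))
                 (norm-cong (face X) m (λ σ _ _ → trans (cong (φ σ xor_) (d-0ᶜ σ)) (xor-identityʳ (φ σ)))) ⟩
      ε * 0ℚ + ‖ φ ‖ suc k  ≡⟨ cong (_+ ‖ φ ‖ suc k) (ℚₚ.*-zeroʳ ε) ⟩
      0ℚ + ‖ φ ‖ suc k      ≡⟨ ℚₚ.+-identityˡ (‖ φ ‖ suc k) ⟩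
      ‖ φ ‖ suc k           ∎
      where open ≡-Reasoning

  nonzero-locMin-cocycle-large : ∀ {C ε} → SmallLocMinNotCocycle X n m C ε → ∀ k (k<n : suc k ℕ.≤ n) φ →
    AgreeOn (face X) (suc (suc k)) (d φ) 0ᶜ → LocMin X m ε k φ → Nonzero (face X) (suc k) φ →
    C (Fin.fromℕ< k<n) * mass (face X) m (suc k) < ‖ φ ‖ suc k
  nonzero-locMin-cocycle-large {C} {ε} hyp k k<n φ cocycle locMin nonzero
    with ‖ φ ‖ suc k ℚₚ.≤? C (Fin.fromℕ< k<n) * mass (face X) m (suc k)
  ... | no  large = ℚₚ.≰⇒> large
  ... | yes small = ⊥-elim (ℚₚ.<-irrefl (sym (norm-vanishing (face X) m cocycle)) (hyp-at-k nonzero locMin small))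
    where
    hyp-at-k : Nonzero (face X) (suc k) φ → LocMin X m ε k φ →
      ‖ φ ‖ suc k ≤ C (Fin.fromℕ< k<n) * mass (face X) m (suc k) → 0ℚ < ‖ d φ ‖ suc (suc k)
    hyp-at-k = subst (λ j → Nonzero (face X) (suc j) φ → LocMin X m ε j φ →
                              ‖ φ ‖ suc j ≤ C (Fin.fromℕ< k<n) * mass (face X) m (suc j) → 0ℚ < ‖ d φ ‖ suc (suc j))
                     (Finₚ.toℕ-fromℕ< k<n) (hyp (Fin.fromℕ< k<n) φ)

module Bounds {N} (X : Complex N) (n : ℕ) (m : Simplex N → ℚ) (weight : IsWeight X n m)
  (C : Fin n → ℚ) (Cpos : ∀ i → 0ℚ < C i) (ε : ℚ) (εpos : 0ℚ < ε) (hyp : SmallLocMinNotCocycle X n m C ε) where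

  open Weighted X n m weight

  ε≥0 : 0ℚ ≤ ε
  ε≥0 = ℚₚ.<⇒≤ εpos

  μ : ℚ
  μ = μconst n ε εpos C Cpos

  systole-bound : ∀ k → suc k ℕ.≤ n → ∀ φ → AgreeOn (face X) (suc (suc k)) (d φ) 0ᶜ →
    ¬ (Σ (Cochain N) λ ψ → AgreeOn (face X) (suc k) (d ψ) φ) →
    νconst n C * mass (face X) m (suc k) ≤ ‖ φ ‖ suc k
  systole-bound k k<n φ cocycle not-coboundary = by-cases (Nonzero⊎Vanishes (suc k) φ*)
    where
    filling : Σ (Cochain N) λ ψ → AlmostMinimal ε k (φ +ᶜ d ψ) × fillingCost ε k φ ψ ≤ ‖ φ ‖ suc k
    filling = optimal-filling ε≥0 k φ
    ψ φ* : Cochain N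
    ψ  = proj₁ filling
    φ* = φ +ᶜ d ψ
    ‖φ*‖≤‖φ‖ : ‖ φ* ‖ suc k ≤ ‖ φ ‖ suc k
    ‖φ*‖≤‖φ‖ = p+q≤r⇒q≤r (*-nonneg ε≥0 (norm-nonneg k ψ)) (proj₂ (proj₂ filling))
    by-cases : Nonzero (face X) (suc k) φ* ⊎ AgreeOn (face X) (suc k) φ* 0ᶜ →
               νconst n C * mass (face X) m (suc k) ≤ ‖ φ ‖ suc k
    by-cases (inj₂ φ*≈0) = ⊥-elim (not-coboundary (ψ , λ σ σ∈X card≡ → sym (xor≡false⇒≡ (φ σ) (d ψ σ) (φ*≈0 σ σ∈X card≡))))
    by-cases (inj₁ φ*≢0) = ℚₚ.<⇒≤ (begin-strict
      νconst n C * mass (face X) m (suc k)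
        ≤⟨ ℚₚ.*-monoʳ-≤-nonNeg (mass (face X) m (suc k)) {{ℚ.nonNegative (mass-nonneg (suc k))}} (ν≤C C (Fin.fromℕ< k<n)) ⟩
      C (Fin.fromℕ< k<n) * mass (face X) m (suc k)
        <⟨ nonzero-locMin-cocycle-large {C = C} hyp k k<n φ* (λ σ σ∈X card≡ → trans (d-+ᶜ-d φ ψ σ) (cocycle σ σ∈X card≡))
             (almostMinimal⇒LocMin k φ* ε≥0 (ℕₚ.<⇒≤ k<n) (proj₁ (proj₂ filling))) φ*≢0 ⟩
      ‖ φ* ‖ suc k
        ≤⟨ ‖φ*‖≤‖φ‖ ⟩
      ‖ φ ‖ suc k ∎)
      where open ℚₚ.≤-Reasoning

  norm-≤-μ*large : ∀ k (k+1<n : suc (suc k) ℕ.≤ n) ψ₀ φ →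
    C (Fin.fromℕ< k+1<n) * mass (face X) m (suc (suc k)) < ‖ φ ‖ suc (suc k) → ‖ ψ₀ ‖ suc k ≤ μ * ‖ φ ‖ suc (suc k)
  norm-≤-μ*large k k+1<n ψ₀ φ large = begin
    ‖ ψ₀ ‖ suc k                                        ≤⟨ norm-≤-mass (suc k) ψ₀ ⟩
    mass (face X) m (suc k)                             ≤⟨ mass-≤-suc (suc k) (ℕₚ.<⇒≤ k+1<n) ⟩
    toℚ (suc (suc k)) * mass (face X) m (suc (suc k))   ≤⟨ ℚₚ.*-monoˡ-≤-nonNeg (toℚ (suc (suc k))) {{ℚ.nonNegative (toℚ-nonneg (suc (suc k)))}} mass≤ ⟩
    toℚ (suc (suc k)) * (inv Cₖ₊₁ (Cpos i) * ‖ φ ‖ suc (suc k))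
      ≡⟨ ℚₚ.*-assoc (toℚ (suc (suc k))) (inv Cₖ₊₁ (Cpos i)) (‖ φ ‖ suc (suc k)) ⟨
    (toℚ (suc (suc k)) * inv Cₖ₊₁ (Cpos i)) * ‖ φ ‖ suc (suc k)
      ≤⟨ ℚₚ.*-monoʳ-≤-nonNeg (‖ φ ‖ suc (suc k)) {{ℚ.nonNegative (norm-nonneg (suc (suc k)) φ)}} coefficient≤μ ⟩
    μ * ‖ φ ‖ suc (suc k)                               ∎
    where
    open ℚₚ.≤-Reasoning
    i : Fin n
    i = Fin.fromℕ< k+1<n
    Cₖ₊₁ : ℚ
    Cₖ₊₁ = C i
    mass≤ : mass (face X) m (suc (suc k)) ≤ inv Cₖ₊₁ (Cpos i) * ‖ φ ‖ suc (suc k)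
    mass≤ = ≤-inv* Cₖ₊₁ (Cpos i) (ℚₚ.<⇒≤ large)
    coefficient≤μ : toℚ (suc (suc k)) * inv Cₖ₊₁ (Cpos i) ≤ μ
    coefficient≤μ = subst (λ j → toℚ (suc j) * inv Cₖ₊₁ (Cpos i) ≤ μ) (Finₚ.toℕ-fromℕ< k+1<n) ([1+i]/Cᵢ≤μ ε εpos C Cpos i)

  cofilling-bound : ∀ k → suc (suc k) ℕ.≤ n → ∀ ψ₀ →
    Σ (Cochain N) λ ψ → AgreeOn (face X) (suc (suc k)) (d ψ) (d ψ₀) × ‖ ψ ‖ suc k ≤ μ * ‖ d ψ₀ ‖ suc (suc k)
  cofilling-bound k k+1<n ψ₀ = by-cases (Nonzero⊎Vanishes (suc (suc k)) φ*)
    where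
    φ : Cochain N
    φ = d ψ₀
    filling : Σ (Cochain N) λ ψ → AlmostMinimal ε (suc k) (φ +ᶜ d ψ) × fillingCost ε (suc k) φ ψ ≤ ‖ φ ‖ suc (suc k)
    filling = optimal-filling ε≥0 (suc k) φ
    ψ φ* : Cochain N
    ψ  = proj₁ filling
    φ* = φ +ᶜ d ψ
    cost≤ : fillingCost ε (suc k) φ ψ ≤ ‖ φ ‖ suc (suc k)
    cost≤ = proj₂ (proj₂ filling)
    by-cases : Nonzero (face X) (suc (suc k)) φ* ⊎ AgreeOn (face X) (suc (suc k)) φ* 0ᶜ →
      Σ (Cochain N) λ ψ′ → AgreeOn (face X) (suc (suc k)) (d ψ′) φ × ‖ ψ′ ‖ suc k ≤ μ * ‖ φ ‖ suc (suc k)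
    by-cases (inj₂ φ*≈0) = ψ , (λ σ σ∈X card≡ → sym (xor≡false⇒≡ (φ σ) (d ψ σ) (φ*≈0 σ σ∈X card≡))) , (begin
      ‖ ψ ‖ suc k                     ≤⟨ ≤-inv* ε εpos (p+q≤r⇒p≤r (norm-nonneg (suc (suc k)) φ*) cost≤) ⟩
      inv ε εpos * ‖ φ ‖ suc (suc k)  ≤⟨ ℚₚ.*-monoʳ-≤-nonNeg (‖ φ ‖ suc (suc k)) {{ℚ.nonNegative (norm-nonneg (suc (suc k)) φ)}}
                                                               (inv-ε≤μ ε εpos C Cpos) ⟩
      μ * ‖ φ ‖ suc (suc k)           ∎)
      where open ℚₚ.≤-Reasoning
    by-cases (inj₁ φ*≢0) = ψ₀ , (λ _ _ _ → refl) , ℚₚ.≤-trans (norm-≤-μ*large k k+1<n ψ₀ φ* large)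
                                                    (ℚₚ.*-monoˡ-≤-nonNeg μ {{ℚ.nonNegative (μ-nonneg ε εpos C Cpos)}} ‖φ*‖≤‖φ‖)
      where
      large : C (Fin.fromℕ< k+1<n) * mass (face X) m (suc (suc k)) < ‖ φ* ‖ suc (suc k)
      large = nonzero-locMin-cocycle-large {C = C} hyp (suc k) k+1<n φ* (λ σ _ _ → trans (d-+ᶜ-d φ ψ σ) (d∘d ψ₀ σ))
                (almostMinimal⇒LocMin (suc k) φ* ε≥0 (ℕₚ.<⇒≤ k+1<n) (proj₁ (proj₂ filling))) φ*≢0
      ‖φ*‖≤‖φ‖ : ‖ φ* ‖ suc (suc k) ≤ ‖ φ ‖ suc (suc k)
      ‖φ*‖≤‖φ‖ = p+q≤r⇒q≤r (*-nonneg ε≥0 (norm-nonneg (suc k) ψ)) cost≤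

lemma6p3 : ∀ {N : ℕ} (X : Complex N) (n : ℕ) → IsPure X n →
    (m : Simplex N → ℚ) → IsWeight X n m →
    (C : Fin n → ℚ) (Cpos : ∀ i → 0ℚ < C i) (ε : ℚ) (εpos : 0ℚ < ε) →
    (∀ (k : Fin n) (φ : Simplex N → Bool) →
       Nonzero (face X) (suc (toℕ k)) φ →
       LocMin X m ε (toℕ k) φ →
       norm (face X) m (suc (toℕ k)) φ ≤ C k * mass (face X) m (suc (toℕ k)) →
       0ℚ < norm (face X) m (suc (suc (toℕ k))) (d φ)) →
    -- (1) μ_k(X) ≤ μ for 0 ≤ k ≤ n-2
    (∀ (k : ℕ) → suc (suc k) ℕ.≤ n → ∀ (ψ₀ : Simplex N → Bool) →
       Nonzero (face X) (suc (suc k)) (d ψ₀) →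
       Σ (Simplex N → Bool) λ ψ →
         AgreeOn (face X) (suc (suc k)) (d ψ) (d ψ₀) ×
         norm (face X) m (suc k) ψ
           ≤ μconst n ε εpos C Cpos * norm (face X) m (suc (suc k)) (d ψ₀))
    ×
    -- (2) ‖φ‖ ≥ ν m(X^{(k)}) for φ ∈ Z^k ∖ B^k, 0 ≤ k ≤ n-1
    (∀ (k : ℕ) → suc k ℕ.≤ n → ∀ (φ : Simplex N → Bool) →
       AgreeOn (face X) (suc (suc k)) (d φ) (λ _ → false) →
       ¬ (Σ (Simplex N → Bool) λ ψ → AgreeOn (face X) (suc k) (d ψ) φ) →
       νconst n C * mass (face X) m (suc k) ≤ norm (face X) m (suc k) φ)
lemma6p3 X n _ m weight C Cpos ε εpos hyp = (λ k k+1<n ψ₀ _ → cofilling-bound k k+1<n ψ₀) , systole-bound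
  where
  open Bounds X n m weight C Cpos ε εpos hyp
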